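{- Let $S$ be a subset of a finite abelian group with $0\in S$ and $|S|\ge 3$. If $S$ is a Sidon set, then $\kappa_2(S)=2|S|-3$.
   Context: For $S$ with $0\in S$, $\langle S\rangle$ is the subgroup generated by $S$. $S$ is $2$-separable if there exists $X\subseteq\langle S\rangle$ with $|X|\ge2$ and $|X+S|\le|\langle S\rangle|-2$; then $\kappa_2(S)=\min\{|X+S|-|X| : X\subseteq\langle S\rangle,\ |X|\ge 2,\ |X+S|\le|\langle S\rangle|-2\}$. If $S$ is not $2$-separable, by convention $\kappa_2(S)=2|S|-3$. A Sidon set is a set in which no two distinct unordered pairs of (not necessarily distinct) elements have the same sum. -}

module Defs where

open import Level using (Level; _⊔_; suc)
open import Algebra.Bundles using (AbelianGroup)
open import Data.Nat using (ℕ; _+_; _≤_)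
open import Data.List using (List; length)
open import Data.List.Relation.Unary.All using (All)
open import Data.Product using (Σ; ∃; _×_; _,_)
open import Data.Sum using (_⊎_)
open import Relation.Binary.PropositionalEquality using (_≡_)
open import Relation.Binary.Definitions using (Decidable)
open import Relation.Nullary using (¬_)
import Data.List.Membership.Setoid as Mem
import Data.List.Relation.Unary.Unique.Setoid as Uniq

record FiniteAbelianGroup (c ℓ : Level) : Set (suc (c ⊔ ℓ)) where
  field
    abGroup  : AbelianGroup c ℓ
  open AbelianGroup abGroup public
  open Mem setoid public using (_∈_)
  open Uniq setoid public using (Unique)
  field
    _≟_      : Decidable _≈_
    elems    : List Carrier
    elems-unique   : Unique elems
    elems-complete : ∀ x → x ∈ elems

module _ {c ℓ : Level} (G : FiniteAbelianGroup c ℓ) where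
  open FiniteAbelianGroup G

  HasCard : ∀ {p} → (Carrier → Set p) → ℕ → Set (c ⊔ ℓ ⊔ p)
  HasCard P n = Σ (List Carrier) λ L →
    length L ≡ n × Unique L × All P L × (∀ x → P x → x ∈ L)

  data Gen (S : List Carrier) : Carrier → Set (c ⊔ ℓ) where
    gen  : ∀ {x} → x ∈ S → Gen S x
    gen0 : Gen S ε
    gen+ : ∀ {x y} → Gen S x → Gen S y → Gen S (x ∙ y)
    gen- : ∀ {x} → Gen S x → Gen S (x ⁻¹)
    gen≈ : ∀ {x y} → x ≈ y → Gen S x → Gen S y

  SumSet : List Carrier → List Carrier → Carrier → Set (c ⊔ ℓ)
  SumSet X S z = ∃ λ x → ∃ λ s → x ∈ X × s ∈ S × z ≈ x ∙ s

  -- X is an admissible set in the definition of 2-separability / κ₂: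
  -- X ⊆ ⟨S⟩, |X| ≥ 2, |X+S| = n, |⟨S⟩| = m, n ≤ m - 2.
  Admissible : List Carrier → List Carrier → ℕ → Set (c ⊔ ℓ)
  Admissible S X n = Unique X × All (Gen S) X × 2 ≤ length X × HasCard (SumSet X S) n
    × ∃ λ m → HasCard (Gen S) m × n + 2 ≤ m

  TwoSeparable : List Carrier → Set (c ⊔ ℓ)
  TwoSeparable S = ∃ λ X → ∃ λ n → Admissible S X n

  -- κ₂(S) = k  (|X+S| - |X| written additively; note |X+S| ≥ |X| as 0 ∈ S).
  Kappa2 : List Carrier → ℕ → Set (c ⊔ ℓ)
  Kappa2 S k =
    (TwoSeparable S
      × (∃ λ X → ∃ λ n → Admissible S X n × k + length X ≡ n)
      × (∀ X n → Admissible S X n → k + length X ≤ n))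
    ⊎ (¬ TwoSeparable S × k ≡ 2 Data.Nat.* length S Data.Nat.∸ 3)

  Sidon : List Carrier → Set (c ⊔ ℓ)
  Sidon S = ∀ {a b a' b'} → a ∈ S → b ∈ S → a' ∈ S → b' ∈ S →
    a ∙ b ≈ a' ∙ b' → (a ≈ a' × b ≈ b') ⊎ (a ≈ b' × b ≈ a')

{-# OPTIONS --safe #-}
-- Hamidoune's isoperimetric method.  Call B ⊆ H = ⟨S⟩ a Sidon basis if it is a Sidon set of size k
-- containing 0 that generates H; both S and -S are Sidon bases.  Suppose some A ⊆ H with |A| ≥ 2 and
-- |A + B| ≤ |H| - 2 has |A + B| < |A| + 2k - 3, and choose one of minimal excess |A + B| - |A|, then
-- of minimal size, over all Sidon bases B.  Minimality applied to the complement of A + B and -B gives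
-- |A + B| + |A| ≤ |H|, and submodularity of X ↦ |X + B| gives the intersection property:
-- |A ∩ (A + d)| ≥ 2 forces A = A + d.  The translates a + B (a ∈ A) pairwise meet in at most one
-- point because B is Sidon, so Bonferroni's inequality gives k|A| - C(|A|, 2) ≤ |A + B|, whence
-- |A| > 2k - 3.  If two translates A + b, A + b' (b, b' ∈ B) meet twice, A is periodic; then either
-- A is invariant under B, so A = H, or A is disjoint from some A + b, so |A + B| ≥ 2|A|.  Otherwise
-- Bonferroni gives k|A| - C(k, 2) ≤ |A + B|.  Each case contradicts |A + B| < |A| + 2k - 3 < 2|A|.
-- The bound is attained by {0, s} for s ∈ S \ {0}, since s lies in S ∩ (s + S); when that pair is
-- too large to be admissible, the bound shows that S is not 2-separable at all.
module Submission where

open import Defs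
open import Level using (Level; _⊔_)
open import Data.Bool using (Bool; true; false; T; _∧_; _∨_; not)
open import Data.Bool.Properties using (T-∧; T-∨; ∧-distribˡ-∨)
open import Data.Nat using (ℕ; zero; suc; _+_; _*_; _∸_; _≤_; _<_; _≤?_; z≤n; s≤s; s≤s⁻¹)
open import Data.Nat.Properties hiding (_≟_)
open import Data.List using (List; []; _∷_; length; filterᵇ; map)
open import Data.Bool.ListAction using (any)
open import Data.List.Properties using (filter-all; filter-none; filter-some; length-filter)
open import Data.List.Relation.Unary.All using (All; []; _∷_)
open import Data.List.Relation.Unary.AllPairs using (AllPairs; []; _∷_)
open import Data.List.Relation.Unary.Any as Any using (here; there)
open import Data.Product using (∃; ∃₂; _×_; _,_; proj₁; proj₂)
open import Data.Sum using (_⊎_; inj₁; inj₂; [_,_]′)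
open import Data.Empty using (⊥; ⊥-elim)
open import Data.Unit using (tt)
open import Function using (_∘_; _$_; case_of_; Equivalence)
open import Function.Definitions using (Congruent)
open import Relation.Binary.Bundles using (DecSetoid)
open import Relation.Nullary using (¬_; yes; no; does; contradiction)
open import Relation.Nullary.Decidable using (T?)
open import Relation.Binary.PropositionalEquality as ≡ using (_≡_; cong; cong₂; subst; subst₂)

module Arithmetic where
  open import Data.Nat.Tactic.RingSolver using (solve-∀)

  C₂ : ℕ → ℕ
  C₂ zero    = 0
  C₂ (suc m) = m + C₂ m

  C₂-double : ∀ m → C₂ (suc m) + C₂ (suc m) ≡ suc m * m
  C₂-double zero    = ≡.refl
  C₂-double (suc m) = begin
    (suc m + C₂ (suc m)) + (suc m + C₂ (suc m)) ≡⟨ regroup m (C₂ (suc m)) ⟩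
    suc m + suc m + (C₂ (suc m) + C₂ (suc m))   ≡⟨ cong (suc m + suc m +_) (C₂-double m) ⟩
    suc m + suc m + suc m * m                   ≡⟨ expand m ⟩
    suc (suc m) * suc m                         ∎
    where
    open ≡.≡-Reasoning
    regroup : ∀ m t → (suc m + t) + (suc m + t) ≡ suc m + suc m + (t + t)
    regroup = solve-∀
    expand : ∀ m → suc m + suc m + suc m * m ≡ suc (suc m) * suc m
    expand = solve-∀

  -- Linear combinations of inequalities are refuted by exhibiting their sum in this form.
  refute : ∀ {l r} d → l ≡ r + suc d → ¬ (l ≤ r)
  refute {r = r} d ≡.refl = m+1+n≰m r

  -- Below, k = 3 + j is the size of a Sidon set and K = 2k - 3 = 3 + j + j.

  -- The hypotheses force (α - 2)(K - α) < 0.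
  small-excess⇒K<α : ∀ j {α σ} → 2 ≤ α → α * (3 + j) ≤ σ + C₂ α →
                     σ < α + (3 + j + j) → 3 + j + j < α
  small-excess⇒K<α j {α} {σ} 2≤α bound excess with α ≤? 3 + j + j
  ... | no α≰K = ≰⇒> α≰K
  ... | yes α≤K with m≤n⇒∃[o]m+o≡n 2≤α | m≤n⇒∃[o]m+o≡n α≤K
  ... | a , ≡.refl | b , α+b≡K = contradiction sum (refute (1 + a * b) (totals j a b σ (C₂ α)))
    where
    a+b≡K-2 : a + b ≡ 1 + j + j
    a+b≡K-2 = cong (_∸ 2) α+b≡K
    sum : α * (3 + j) + (α * (3 + j) + (suc σ + (suc σ + (C₂ α + C₂ α + a * (a + b)))))
        ≤ (σ + C₂ α) + ((σ + C₂ α) + ((α + (3 + j + j)) + ((α + (3 + j + j)) + (α * (1 + a) + a * (1 + j + j)))))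
    sum = +-mono-≤ bound (+-mono-≤ bound (+-mono-≤ excess (+-mono-≤ excess
            (+-mono-≤ (≤-reflexive (C₂-double (1 + a))) (≤-reflexive (cong (a *_) a+b≡K-2))))))
    totals : ∀ j a b σ t →
      (2 + a) * (3 + j) + ((2 + a) * (3 + j) + (suc σ + (suc σ + (t + t + a * (a + b)))))
      ≡ (σ + t) + ((σ + t) + (((2 + a) + (3 + j + j)) + (((2 + a) + (3 + j + j))
          + ((2 + a) * (1 + a) + a * (1 + j + j))))) + suc (1 + a * b)
    totals = solve-∀

  -- For α > K the hypotheses give 3k² - 11k + 12 ≤ 0, which has no solution.
  small-excess-absurd : ∀ j {α σ} → 3 + j + j < α → (3 + j) * α ≤ σ + C₂ (3 + j) →
                        σ < α + (3 + j + j) → ⊥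
  small-excess-absurd j {α} {σ} K<α bound excess with m≤n⇒∃[o]m+o≡n K<α
  ... | e , ≡.refl = contradiction sum
        (refute (5 + 7 * j + 4 * e + 3 * (j * j) + 2 * (e * j)) (totals j e σ (C₂ (3 + j))))
    where
    sum : (3 + j) * α + ((3 + j) * α + (suc σ + (suc σ + (C₂ (3 + j) + C₂ (3 + j)))))
        ≤ (σ + C₂ (3 + j)) + ((σ + C₂ (3 + j)) + ((α + (3 + j + j)) + ((α + (3 + j + j)) + (3 + j) * (2 + j))))
    sum = +-mono-≤ bound (+-mono-≤ bound (+-mono-≤ excess (+-mono-≤ excess (≤-reflexive (C₂-double (2 + j))))))
    totals : ∀ j e σ t →
      (3 + j) * (4 + j + j + e) + ((3 + j) * (4 + j + j + e) + (suc σ + (suc σ + (t + t))))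
      ≡ (σ + t) + ((σ + t) + (((4 + j + j + e) + (3 + j + j)) + (((4 + j + j + e) + (3 + j + j)) + (3 + j) * (2 + j))))
        + suc (5 + 7 * j + 4 * e + 3 * (j * j) + 2 * (e * j))
    totals = solve-∀

module Counting {c ℓ} (D : DecSetoid c ℓ) where
  open DecSetoid D
  open import Data.List.Membership.DecSetoid D using (_∈?_)
  open import Data.List.Membership.Setoid setoid using (_∈_; find; lose)
  open import Data.List.Relation.Unary.Any.Properties using (any⁺; any⁻)
  open import Data.List.Membership.Setoid.Properties using (∈-resp-≈)
  open import Data.List.Relation.Unary.Unique.Setoid setoid using (Unique)
  open import Data.List.Relation.Unary.Unique.Setoid.Properties using (Unique[x∷xs]⇒x∉xs)
  import Data.List.Relation.Unary.All as All
  import Data.List.Relation.Unary.AllPairs as AllPairs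
  open Arithmetic using (C₂)
  open import Algebra.Properties.CommutativeSemigroup +-commutativeSemigroup using (xy∙z≈y∙xz)

  Subset : Set c
  Subset = Carrier → Bool

  Congruent≈ : Subset → Set (c ⊔ ℓ)
  Congruent≈ = Congruent _≈_ _≡_

  infixr 7 _∩_
  infixr 6 _∪_
  infix 4 _⊆[_]_

  _∩_ _∪_ : Subset → Subset → Subset
  (p ∩ q) x = p x ∧ q x
  (p ∪ q) x = p x ∨ q x

  ∁ : Subset → Subset
  ∁ p x = not (p x)

  ｛_｝ : Carrier → Subset
  ｛ m ｝ x = does (x ≟ m)

  member : List Carrier → Subset
  member M x = does (x ∈? M)

  ⋃ : ∀ {i} {I : Set i} → (I → Subset) → List I → Subset
  ⋃ F is x = any (λ i → F i x) is

  _⊆[_]_ : Subset → List Carrier → Subset → Set (c ⊔ ℓ)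
  p ⊆[ L ] q = ∀ {x} → x ∈ L → T (p x) → T (q x)

  count : Subset → List Carrier → ℕ
  count p L = length (filterᵇ p L)

  mkCongruent : ∀ {p} → (∀ {x y} → x ≈ y → T (p x) → T (p y)) → Congruent≈ p
  mkCongruent {p} resp {x} {y} x≈y with p x in px | p y in py
  ... | true  | true  = ≡.refl
  ... | false | false = ≡.refl
  ... | true  | false = ⊥-elim (subst T py (resp x≈y (subst T (≡.sym px) tt)))
  ... | false | true  = ⊥-elim (subst T px (resp (sym x≈y) (subst T (≡.sym py) tt)))

  T-resp : ∀ {p} → Congruent≈ p → ∀ {x y} → x ≈ y → T (p x) → T (p y)
  T-resp p-cong x≈y = subst T (p-cong x≈y)

  ∩-cong : ∀ {p q} → Congruent≈ p → Congruent≈ q → Congruent≈ (p ∩ q)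
  ∩-cong p-cong q-cong x≈y = cong₂ _∧_ (p-cong x≈y) (q-cong x≈y)

  ∪-cong : ∀ {p q} → Congruent≈ p → Congruent≈ q → Congruent≈ (p ∪ q)
  ∪-cong p-cong q-cong x≈y = cong₂ _∨_ (p-cong x≈y) (q-cong x≈y)

  ∁-cong : ∀ {p} → Congruent≈ p → Congruent≈ (∁ p)
  ∁-cong p-cong x≈y = cong not (p-cong x≈y)

  ∩⁺ : ∀ p q {x} → T (p x) → T (q x) → T ((p ∩ q) x)
  ∩⁺ p q px qx = Equivalence.from T-∧ (px , qx)

  ∩⁻ : ∀ p q {x} → T ((p ∩ q) x) → T (p x) × T (q x)
  ∩⁻ p q {x} = Equivalence.to (T-∧ {p x} {q x})

  ∪⁺ˡ : ∀ p q {x} → T (p x) → T ((p ∪ q) x)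
  ∪⁺ˡ p q px = Equivalence.from T-∨ (inj₁ px)

  ∪⁺ʳ : ∀ p q {x} → T (q x) → T ((p ∪ q) x)
  ∪⁺ʳ p q {x} qx = Equivalence.from (T-∨ {p x}) (inj₂ qx)

  ∪⁻ : ∀ p q {x} → T ((p ∪ q) x) → T (p x) ⊎ T (q x)
  ∪⁻ p q {x} = Equivalence.to (T-∨ {p x} {q x})

  ∁⁺ : ∀ p {x} → ¬ T (p x) → T (∁ p x)
  ∁⁺ p {x} ¬px with p x
  ... | true  = ¬px tt
  ... | false = tt

  ∁⁻ : ∀ p {x} → T (∁ p x) → ¬ T (p x)
  ∁⁻ p {x} ∁px px with p x
  ... | false = px

  member⁺ : ∀ {M x} → x ∈ M → T (member M x)
  member⁺ {M} {x} x∈M with x ∈? M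
  ... | yes _   = tt
  ... | no x∉M = x∉M x∈M

  member⁻ : ∀ {M x} → T (member M x) → x ∈ M
  member⁻ {M} {x} t with x ∈? M
  ... | yes x∈M = x∈M

  member-cong : ∀ M → Congruent≈ (member M)
  member-cong M = mkCongruent λ x≈y → member⁺ {M} ∘ ∈-resp-≈ setoid x≈y ∘ member⁻

  ｛｝⁺ : ∀ {m x} → x ≈ m → T (｛ m ｝ x)
  ｛｝⁺ {m} {x} x≈m with x ≟ m
  ... | yes _   = tt
  ... | no x≉m = x≉m x≈m

  ｛｝⁻ : ∀ {m x} → T (｛ m ｝ x) → x ≈ m
  ｛｝⁻ {m} {x} t with x ≟ m
  ... | yes x≈m = x≈m

  ｛｝-cong : ∀ m → Congruent≈ ｛ m ｝
  ｛｝-cong m = mkCongruent λ x≈y → ｛｝⁺ ∘ trans (sym x≈y) ∘ ｛｝⁻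

  ⋃⁺ : ∀ (F : Carrier → Subset) → (∀ {x i j} → i ≈ j → T (F i x) → T (F j x)) →
       ∀ {is i x} → i ∈ is → T (F i x) → T (⋃ F is x)
  ⋃⁺ F F-resp i∈ Fix = any⁺ _ (lose F-resp i∈ Fix)

  ⋃⁻ : ∀ (F : Carrier → Subset) is {x} → T (⋃ F is x) → ∃ λ i → i ∈ is × T (F i x)
  ⋃⁻ F is t = find (any⁻ _ is t)

  count-mono : ∀ {p q} L → p ⊆[ L ] q → count p L ≤ count q L
  count-mono [] _ = z≤n
  count-mono {p} {q} (x ∷ xs) p⊆q with p x in px | q x in qx
  ... | true  | true  = s≤s (count-mono xs (p⊆q ∘ there))
  ... | true  | false = ⊥-elim (subst T qx (p⊆q (here refl) (subst T (≡.sym px) tt)))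
  ... | false | true  = m≤n⇒m≤1+n (count-mono xs (p⊆q ∘ there))
  ... | false | false = count-mono xs (p⊆q ∘ there)

  count-≐ : ∀ {p q} L → p ⊆[ L ] q → q ⊆[ L ] p → count p L ≡ count q L
  count-≐ L p⊆q q⊆p = ≤-antisym (count-mono L p⊆q) (count-mono L q⊆p)

  count-cong : ∀ {p q} L → (∀ {x} → x ∈ L → p x ≡ q x) → count p L ≡ count q L
  count-cong L p≗q = count-≐ L (λ x∈ → subst T (p≗q x∈)) (λ x∈ → subst T (≡.sym (p≗q x∈)))

  count-∩-∪ : ∀ p q L → count p L + count q L ≡ count (p ∩ q) L + count (p ∪ q) L
  count-∩-∪ p q [] = ≡.refl
  count-∩-∪ p q (x ∷ xs) with p x | q x | count-∩-∪ p q xs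
  ... | true  | true  | ih = cong suc (≡.trans (+-suc _ _) (≡.trans (cong suc ih) (≡.sym (+-suc _ _))))
  ... | true  | false | ih = ≡.trans (cong suc ih) (≡.sym (+-suc _ _))
  ... | false | true  | ih = ≡.trans (+-suc _ _) (≡.trans (cong suc ih) (≡.sym (+-suc _ _)))
  ... | false | false | ih = ih

  count-∪ : ∀ p q L → count (p ∪ q) L ≤ count p L + count q L
  count-∪ p q L = ≤-trans (m≤n+m _ _) (≤-reflexive (≡.sym (count-∩-∪ p q L)))

  count-∁ : ∀ p L → count p L + count (∁ p) L ≡ length L
  count-∁ p [] = ≡.refl
  count-∁ p (x ∷ xs) with p x
  ... | true  = cong suc (count-∁ p xs)
  ... | false = ≡.trans (+-suc _ _) (cong suc (count-∁ p xs))

  count-all : ∀ {p} L → (∀ {x} → x ∈ L → T (p x)) → count p L ≡ length L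
  count-all {p} L all = cong length (filter-all (T? ∘ p) (All.tabulateₛ setoid all))

  count-none : ∀ {p} L → (∀ {x} → x ∈ L → ¬ T (p x)) → count p L ≡ 0
  count-none {p} L none = cong length (filter-none (T? ∘ p) (All.tabulateₛ setoid none))

  ⊆∧count≥⇒⊇ : ∀ {p q} L → Congruent≈ p → Congruent≈ q →
               p ⊆[ L ] q → count q L ≤ count p L → q ⊆[ L ] p
  ⊆∧count≥⇒⊇ {p} {q} (y ∷ ys) p-cong q-cong p⊆q q≤p {x} x∈ qx with p y in py | q y in qy
  ... | true  | true  = case x∈ of λ where
    (here x≈y)  → T-resp p-cong (sym x≈y) (subst T (≡.sym py) tt)
    (there x∈′) → ⊆∧count≥⇒⊇ ys p-cong q-cong (p⊆q ∘ there) (s≤s⁻¹ q≤p) x∈′ qx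
  ... | true  | false = ⊥-elim (subst T qy (p⊆q (here refl) (subst T (≡.sym py) tt)))
  ... | false | true  = ⊥-elim (<⇒≱ q≤p (count-mono ys (p⊆q ∘ there)))
  ... | false | false = case x∈ of λ where
    (here x≈y)  → ⊥-elim (subst T qy (T-resp q-cong x≈y qx))
    (there x∈′) → ⊆∧count≥⇒⊇ ys p-cong q-cong (p⊆q ∘ there) q≤p x∈′ qx

  count-pos⇒∃ : ∀ {p} L → 1 ≤ count p L → ∃ λ x → x ∈ L × T (p x)
  count-pos⇒∃ {p} (x ∷ xs) pos with p x in px
  ... | true  = x , here refl , subst T (≡.sym px) tt
  ... | false = let y , y∈ , py = count-pos⇒∃ xs pos in y , there y∈ , py

  count≥2⇒∃₂ : ∀ {p} L → Unique L → 2 ≤ count p L →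
               ∃₂ λ x y → x ∈ L × y ∈ L × x ≉ y × T (p x) × T (p y)
  count≥2⇒∃₂ {p} (x ∷ xs) x∷xs! two with p x in px
  ... | true  = let y , y∈ , py = count-pos⇒∃ xs (s≤s⁻¹ two) in
    x , y , here refl , there y∈ ,
    (λ x≈y → Unique[x∷xs]⇒x∉xs setoid x∷xs! (∈-resp-≈ setoid (sym x≈y) y∈)) ,
    subst T (≡.sym px) tt , py
  ... | false = let y , z , y∈ , z∈ , rest = count≥2⇒∃₂ xs (AllPairs.tail x∷xs!) two in
    y , z , there y∈ , there z∈ , rest

  ∈⇒count-pos : ∀ {p} L → Congruent≈ p → ∀ {x} → x ∈ L → T (p x) → 1 ≤ count p L
  ∈⇒count-pos {p} L p-cong x∈ px = filter-some (T? ∘ p) (Any.map (λ x≈y → T-resp p-cong x≈y px) x∈)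

  count-｛｝ : ∀ {m} L → Unique L → m ∈ L → count ｛ m ｝ L ≡ 1
  count-｛｝ {m} L L! m∈ = ≤-antisym at-most-one (∈⇒count-pos L (｛｝-cong m) m∈ (｛｝⁺ refl))
    where
    at-most-one : count ｛ m ｝ L ≤ 1
    at-most-one with count ｛ m ｝ L ≤? 1
    ... | yes ≤1 = ≤1
    ... | no  ≰1 = let _ , _ , _ , _ , x≉y , x≈m , y≈m = count≥2⇒∃₂ L L! (≰⇒> ≰1) in
      ⊥-elim (x≉y (trans (｛｝⁻ x≈m) (sym (｛｝⁻ y≈m))))

  ∈₂⇒count≥2 : ∀ {p} L → Unique L → Congruent≈ p → ∀ {x y} → x ∈ L → y ∈ L → x ≉ y →
               T (p x) → T (p y) → 2 ≤ count p L
  ∈₂⇒count≥2 {p} L L! p-cong {x} {y} x∈ y∈ x≉y px py = begin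
    2                                                ≡⟨ cong₂ _+_ (count-｛｝ L L! x∈) (count-｛｝ L L! y∈) ⟨
    count ｛ x ｝ L + count ｛ y ｝ L                     ≡⟨ count-∩-∪ ｛ x ｝ ｛ y ｝ L ⟩
    count (｛ x ｝ ∩ ｛ y ｝) L + count (｛ x ｝ ∪ ｛ y ｝) L ≡⟨ cong (_+ count (｛ x ｝ ∪ ｛ y ｝) L) (count-none L disjoint) ⟩
    count (｛ x ｝ ∪ ｛ y ｝) L                          ≤⟨ count-mono L (λ _ → both) ⟩
    count p L                                        ∎
    where
    open ≤-Reasoning
    both : ∀ {z} → T ((｛ x ｝ ∪ ｛ y ｝) z) → T (p z)
    both z∈xy with ∪⁻ ｛ x ｝ ｛ y ｝ z∈xy
    ... | inj₁ z≈x = T-resp p-cong (sym (｛｝⁻ z≈x)) px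
    ... | inj₂ z≈y = T-resp p-cong (sym (｛｝⁻ z≈y)) py
    disjoint : ∀ {z} → z ∈ L → ¬ T ((｛ x ｝ ∩ ｛ y ｝) z)
    disjoint _ z∈xy = let z≈x , z≈y = ∩⁻ ｛ x ｝ ｛ y ｝ z∈xy in x≉y (trans (sym (｛｝⁻ z≈x)) (｛｝⁻ z≈y))

  count-member : ∀ {U M} → Unique U → Unique M → (∀ {x} → x ∈ M → x ∈ U) →
                 length M ≡ count (member M) U
  count-member {U} {[]}    _  _  _    = ≡.sym (count-none U (λ _ ()))
  count-member {U} {m ∷ M} U! m∷M! M⊆U = begin
    suc (length M)                                         ≡⟨ cong₂ _+_ (≡.sym (count-｛｝ U U! (M⊆U (here refl))))
                                                                 (count-member U! (AllPairs.tail m∷M!) (M⊆U ∘ there)) ⟩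
    count ｛ m ｝ U + count (member M) U                     ≡⟨ count-∩-∪ ｛ m ｝ (member M) U ⟩
    count (｛ m ｝ ∩ member M) U + count (member (m ∷ M)) U ≡⟨ cong (_+ count (member (m ∷ M)) U) (count-none U m∉M) ⟩
    count (member (m ∷ M)) U                               ∎
    where
    open ≡.≡-Reasoning
    m∉M : ∀ {x} → x ∈ U → ¬ T ((｛ m ｝ ∩ member M) x)
    m∉M _ x∈ = let x≈m , x∈M = ∩⁻ ｛ m ｝ (member M) x∈ in
      Unique[x∷xs]⇒x∉xs setoid m∷M! (∈-resp-≈ setoid (｛｝⁻ x≈m) (member⁻ x∈M))

  distinct-pairs : ∀ {r} {R : Carrier → Carrier → Set r} {L} → Unique L →
                   (∀ {x y} → x ∈ L → y ∈ L → x ≉ y → R x y) → AllPairs R L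
  distinct-pairs {L = []}     []       _          = []
  distinct-pairs {L = x ∷ xs} x∷xs! R-distinct =
    All.tabulateₛ setoid (λ y∈ → R-distinct (here refl) (there y∈)
                                   (λ x≈y → Unique[x∷xs]⇒x∉xs setoid x∷xs! (∈-resp-≈ setoid (sym x≈y) y∈))) ∷
    distinct-pairs (AllPairs.tail x∷xs!) (λ x∈ y∈ → R-distinct (there x∈) (there y∈))

  count-∩-⋃ : ∀ {i} {I : Set i} q (F : I → Subset) L is →
              All (λ i → count (q ∩ F i) L ≤ 1) is → count (q ∩ ⋃ F is) L ≤ length is
  count-∩-⋃ q F L []       []           = ≤-reflexive (count-none L (λ _ → proj₂ ∘ ∩⁻ q (⋃ F [])))
  count-∩-⋃ q F L (i ∷ is) (≤1 ∷ ≤1s) = begin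
    count (q ∩ ⋃ F (i ∷ is)) L              ≡⟨ count-cong L (λ {x} _ → ∧-distribˡ-∨ (q x) (F i x) (⋃ F is x)) ⟩
    count (q ∩ F i ∪ q ∩ ⋃ F is) L          ≤⟨ count-∪ (q ∩ F i) (q ∩ ⋃ F is) L ⟩
    count (q ∩ F i) L + count (q ∩ ⋃ F is) L ≤⟨ +-mono-≤ ≤1 (count-∩-⋃ q F L is ≤1s) ⟩
    suc (length is)                          ∎
    where open ≤-Reasoning

  bonferroni : ∀ {i} {I : Set i} (F : I → Subset) L s is →
               All (λ i → s ≤ count (F i) L) is → AllPairs (λ i j → count (F i ∩ F j) L ≤ 1) is →
               length is * s ≤ count (⋃ F is) L + C₂ (length is)
  bonferroni F L s []       []            []          = z≤n
  bonferroni F L s (i ∷ is) (s≤Fi ∷ s≤F) (≤1 ∷ ≤1s) = begin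
    s + m * s                                       ≤⟨ +-mono-≤ s≤Fi (bonferroni F L s is s≤F ≤1s) ⟩
    count (F i) L + (count U L + C₂ m)              ≡⟨ ≡.sym (+-assoc (count (F i) L) _ _) ⟩
    count (F i) L + count U L + C₂ m                ≡⟨ cong (_+ C₂ m) (count-∩-∪ (F i) U L) ⟩
    count (F i ∩ U) L + count (F i ∪ U) L + C₂ m   ≤⟨ +-monoˡ-≤ (C₂ m) (+-monoˡ-≤ _ (count-∩-⋃ (F i) F L is ≤1)) ⟩
    m + count (F i ∪ U) L + C₂ m                    ≡⟨ xy∙z≈y∙xz m _ (C₂ m) ⟩
    count (F i ∪ U) L + (m + C₂ m)                  ∎
    where
    open ≤-Reasoning
    m : ℕ
    m = length is
    U : Subset
    U = ⋃ F is

  module Saturation {i} (E : List Carrier) (E-complete : ∀ x → x ∈ E)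
    (Inv : Subset → Set i) (Inv⇒cong : ∀ {p} → Inv p → Congruent≈ p)
    (step : Subset → Subset) (step-inv : ∀ {p} → Inv p → Inv (step p))
    (step-inflationary : ∀ p {x} → T (p x) → T (step p x)) where

    saturate : ℕ → Subset → Subset
    saturate zero    p = p
    saturate (suc f) p with count (step p) E ≤? count p E
    ... | yes _ = p
    ... | no  _ = saturate f (step p)

    saturate-inv : ∀ f {p} → Inv p → Inv (saturate f p)
    saturate-inv zero    inv = inv
    saturate-inv (suc f) {p} inv with count (step p) E ≤? count p E
    ... | yes _ = inv
    ... | no  _ = saturate-inv f (step-inv inv)

    saturate-inflationary : ∀ f p {x} → T (p x) → T (saturate f p x)
    saturate-inflationary zero    p px = px
    saturate-inflationary (suc f) p px with count (step p) E ≤? count p E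
    ... | yes _ = px
    ... | no  _ = saturate-inflationary f (step p) (step-inflationary p px)

    private
      stable : ∀ {p} → Inv p → count (step p) E ≤ count p E → ∀ {x} → T (step p x) → T (p x)
      stable inv ≤p = ⊆∧count≥⇒⊇ E (Inv⇒cong inv) (Inv⇒cong (step-inv inv))
                        (λ _ → step-inflationary _) ≤p (E-complete _)

    -- Each unstable round adds an element, so length E rounds suffice.
    saturate-closed : ∀ f {p} → Inv p → length E ≤ f + count p E →
                      ∀ {x} → T (step (saturate f p) x) → T (saturate f p x)
    saturate-closed zero    {p} inv full = stable inv (≤-trans (length-filter (T? ∘ step p) E) full)
    saturate-closed (suc f) {p} inv full with count (step p) E ≤? count p E
    ... | yes ≤p = stable inv ≤p
    ... | no  ≰p = saturate-closed f (step-inv inv)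
                     (≤-trans full (≤-trans (≤-reflexive (≡.sym (+-suc f _))) (+-monoʳ-≤ f (≰⇒> ≰p))))

decSetoidᶠ : ∀ {c ℓ} → FiniteAbelianGroup c ℓ → DecSetoid c ℓ
decSetoidᶠ G = record { isDecEquivalence = record { isEquivalence = isEquivalence ; _≟_ = _≟_ } }
  where open FiniteAbelianGroup G

module GroupSubsets {c ℓ} (G : FiniteAbelianGroup c ℓ) where
  open FiniteAbelianGroup G
  open Counting (decSetoidᶠ G) public
  open import Algebra.Properties.Group group
    using (//-rightDividesˡ; //-rightDividesʳ; ∙-cancelˡ; ∙-cancelʳ; ⁻¹-injective; ⁻¹-involutive)
  open import Algebra.Properties.AbelianGroup abGroup using (⁻¹-∙-comm)
  open import Data.List.Membership.Setoid.Properties using (∈-map⁻)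
  import Data.Sum as Sum
  import Data.Product as Product
  open import Algebra.Properties.CommutativeSemigroup commutativeSemigroup using (interchange; xy∙z≈xz∙y)
  import Relation.Binary.Reasoning.Setoid as ≈-Reasoning

  infixl 8 _⊕_ _⊞_

  _⊕_ : Subset → Carrier → Subset
  (A ⊕ d) g = A (g ∙ d ⁻¹)

  _⊞_ : Subset → List Carrier → Subset
  A ⊞ B = ⋃ (A ⊕_) B

  ⊕-cong : ∀ {A} → Congruent≈ A → ∀ d → Congruent≈ (A ⊕ d)
  ⊕-cong A-cong d x≈y = A-cong (∙-congʳ x≈y)

  ⊕-resp : ∀ {A} → Congruent≈ A → ∀ {g d d′} → d ≈ d′ → T ((A ⊕ d) g) → T ((A ⊕ d′) g)
  ⊕-resp A-cong d≈d′ = T-resp A-cong (∙-congˡ (⁻¹-cong d≈d′))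

  ⊕⁺ : ∀ {A} → Congruent≈ A → ∀ {a d g} → T (A a) → g ≈ a ∙ d → T ((A ⊕ d) g)
  ⊕⁺ A-cong {a} {d} Aa g≈ad = T-resp A-cong (sym (trans (∙-congʳ g≈ad) (//-rightDividesʳ d a))) Aa

  ⊞-cong : ∀ {A} → Congruent≈ A → ∀ B → Congruent≈ (A ⊞ B)
  ⊞-cong {A} A-cong B = mkCongruent λ x≈y t →
    let d , d∈ , Ax = ⋃⁻ (A ⊕_) B t in ⋃⁺ (A ⊕_) (⊕-resp A-cong) d∈ (T-resp (⊕-cong A-cong d) x≈y Ax)

  ⊞⁺ : ∀ {A} → Congruent≈ A → ∀ {B a b g} → T (A a) → b ∈ B → g ≈ a ∙ b → T ((A ⊞ B) g)
  ⊞⁺ {A} A-cong Aa b∈ g≈ab = ⋃⁺ (A ⊕_) (⊕-resp A-cong) b∈ (⊕⁺ A-cong Aa g≈ab)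

  private
    swap-sums : ∀ g₁ g₂ a a′ → (g₁ ∙ a ⁻¹) ∙ (g₂ ∙ a′ ⁻¹) ≈ (g₂ ∙ a ⁻¹) ∙ (g₁ ∙ a′ ⁻¹)
    swap-sums g₁ g₂ a a′ = begin
      (g₁ ∙ a ⁻¹) ∙ (g₂ ∙ a′ ⁻¹) ≈⟨ interchange g₁ (a ⁻¹) g₂ (a′ ⁻¹) ⟩
      (g₁ ∙ g₂) ∙ (a ⁻¹ ∙ a′ ⁻¹) ≈⟨ ∙-congʳ (comm g₁ g₂) ⟩
      (g₂ ∙ g₁) ∙ (a ⁻¹ ∙ a′ ⁻¹) ≈⟨ interchange g₂ g₁ (a ⁻¹) (a′ ⁻¹) ⟩
      (g₂ ∙ a ⁻¹) ∙ (g₁ ∙ a′ ⁻¹) ∎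
      where open ≈-Reasoning setoid

  translates-meet-once : ∀ {B} → Sidon G B → ∀ {a a′} → a ≉ a′ → ∀ L → Unique L →
                         count (member B ⊕ a ∩ member B ⊕ a′) L ≤ 1
  translates-meet-once {B} sidon {a} {a′} a≉a′ L L! with count (member B ⊕ a ∩ member B ⊕ a′) L ≤? 1
  ... | yes ≤1 = ≤1
  ... | no  ≰1 with count≥2⇒∃₂ L L! (≰⇒> ≰1)
  ...   | g₁ , g₂ , _ , _ , g₁≉g₂ , t₁ , t₂ = ⊥-elim $ case sidon u₁∈ v₂∈ u₂∈ v₁∈ (swap-sums g₁ g₂ a a′) of λ where
      (inj₁ (u₁≈u₂ , _)) → g₁≉g₂ (∙-cancelʳ (a ⁻¹) g₁ g₂ u₁≈u₂)
      (inj₂ (u₁≈v₁ , _)) → a≉a′ (⁻¹-injective (∙-cancelˡ g₁ (a ⁻¹) (a′ ⁻¹) u₁≈v₁))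
    where
    u₁∈ : g₁ ∙ a ⁻¹ ∈ B
    u₁∈ = member⁻ (proj₁ (∩⁻ (member B ⊕ a) (member B ⊕ a′) t₁))
    v₁∈ : g₁ ∙ a′ ⁻¹ ∈ B
    v₁∈ = member⁻ (proj₂ (∩⁻ (member B ⊕ a) (member B ⊕ a′) t₁))
    u₂∈ : g₂ ∙ a ⁻¹ ∈ B
    u₂∈ = member⁻ (proj₁ (∩⁻ (member B ⊕ a) (member B ⊕ a′) t₂))
    v₂∈ : g₂ ∙ a′ ⁻¹ ∈ B
    v₂∈ = member⁻ (proj₂ (∩⁻ (member B ⊕ a) (member B ⊕ a′) t₂))

  ⊆⊞ : ∀ {B} → ε ∈ B → ∀ {A} → Congruent≈ A → ∀ {g} → T (A g) → T ((A ⊞ B) g)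
  ⊆⊞ ε∈B A-cong {g} Ag = ⊞⁺ A-cong Ag ε∈B (sym (identityʳ g))

  ⊕⊞⊆⊞⊕ : ∀ {A} → Congruent≈ A → ∀ d B {g} → T ((A ⊕ d ⊞ B) g) → T ((A ⊞ B ⊕ d) g)
  ⊕⊞⊆⊞⊕ {A} A-cong d B {g} t = let b , b∈ , A[g-b-d] = ⋃⁻ (A ⊕ d ⊕_) B t in
    ⋃⁺ (A ⊕_) (⊕-resp A-cong) b∈ (T-resp A-cong (xy∙z≈xz∙y g (b ⁻¹) (d ⁻¹)) A[g-b-d])

  ⊞⊕⊆⊕⊞ : ∀ {A} → Congruent≈ A → ∀ d B {g} → T ((A ⊞ B ⊕ d) g) → T ((A ⊕ d ⊞ B) g)
  ⊞⊕⊆⊕⊞ {A} A-cong d B {g} t = let b , b∈ , A[g-d-b] = ⋃⁻ (A ⊕_) B t in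
    ⋃⁺ (A ⊕ d ⊕_) (⊕-resp (⊕-cong A-cong d)) b∈ (T-resp A-cong (xy∙z≈xz∙y g (d ⁻¹) (b ⁻¹)) A[g-d-b])

  ∩⊞⊆ : ∀ {A A′} → Congruent≈ A → Congruent≈ A′ → ∀ B {g} → T (((A ∩ A′) ⊞ B) g) → T ((A ⊞ B ∩ A′ ⊞ B) g)
  ∩⊞⊆ {A} {A′} A-cong A′-cong B t = let b , b∈ , AA′ = ⋃⁻ ((A ∩ A′) ⊕_) B t ; Ab , A′b = ∩⁻ A A′ AA′ in
    ∩⁺ (A ⊞ B) (A′ ⊞ B) (⋃⁺ (A ⊕_) (⊕-resp A-cong) b∈ Ab) (⋃⁺ (A′ ⊕_) (⊕-resp A′-cong) b∈ A′b)

  ∪⊞⊆ : ∀ {A A′} → Congruent≈ A → Congruent≈ A′ → ∀ B {g} → T (((A ∪ A′) ⊞ B) g) → T ((A ⊞ B ∪ A′ ⊞ B) g)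
  ∪⊞⊆ {A} {A′} A-cong A′-cong B t with ⋃⁻ ((A ∪ A′) ⊕_) B t
  ... | b , b∈ , A∪A′ with ∪⁻ A A′ A∪A′
  ...   | inj₁ Ab  = ∪⁺ˡ (A ⊞ B) (A′ ⊞ B) (⋃⁺ (A ⊕_) (⊕-resp A-cong) b∈ Ab)
  ...   | inj₂ A′b = ∪⁺ʳ (A ⊞ B) (A′ ⊞ B) (⋃⁺ (A′ ⊕_) (⊕-resp A′-cong) b∈ A′b)

  ∁⊞⊆∁ : ∀ {A} → Congruent≈ A → ∀ B {g} → T ((∁ (A ⊞ B) ⊞ map _⁻¹ B) g) → T (∁ A g)
  ∁⊞⊆∁ {A} A-cong B {g} t =
    let b′ , b′∈ , ∁[g-b′] = ⋃⁻ (∁ (A ⊞ B) ⊕_) (map _⁻¹ B) t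
        b , b∈ , b′≈b⁻¹ = ∈-map⁻ setoid setoid b′∈
    in ∁⁺ A λ Ag → ∁⁻ (A ⊞ B) ∁[g-b′] (⊞⁺ A-cong Ag b∈ (∙-congˡ (trans (⁻¹-cong b′≈b⁻¹) (⁻¹-involutive b))))

  sidon-⁻¹ : ∀ {B} → Sidon G B → Sidon G (map _⁻¹ B)
  sidon-⁻¹ sidon {a} {b} {a′} {b′} a∈ b∈ a′∈ b′∈ ab≈a′b′ with ∈-map⁻ setoid setoid a∈ | ∈-map⁻ setoid setoid b∈
                                                         | ∈-map⁻ setoid setoid a′∈ | ∈-map⁻ setoid setoid b′∈
  ... | u , u∈ , a≈u⁻¹ | v , v∈ , b≈v⁻¹ | u′ , u′∈ , a′≈u′⁻¹ | v′ , v′∈ , b′≈v′⁻¹ =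
    Sum.map (Product.map (transfer a≈u⁻¹ a′≈u′⁻¹) (transfer b≈v⁻¹ b′≈v′⁻¹))
            (Product.map (transfer a≈u⁻¹ b′≈v′⁻¹) (transfer b≈v⁻¹ a′≈u′⁻¹))
            (sidon u∈ v∈ u′∈ v′∈ uv≈u′v′)
    where
    transfer : ∀ {x y p q} → x ≈ p ⁻¹ → y ≈ q ⁻¹ → p ≈ q → x ≈ y
    transfer x≈p⁻¹ y≈q⁻¹ p≈q = trans x≈p⁻¹ (trans (⁻¹-cong p≈q) (sym y≈q⁻¹))
    uv≈u′v′ : u ∙ v ≈ u′ ∙ v′
    uv≈u′v′ = ⁻¹-injective (begin
      (u ∙ v) ⁻¹     ≈⟨ ⁻¹-∙-comm u v ⟨
      u ⁻¹ ∙ v ⁻¹    ≈⟨ ∙-cong a≈u⁻¹ b≈v⁻¹ ⟨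
      a ∙ b          ≈⟨ ab≈a′b′ ⟩
      a′ ∙ b′        ≈⟨ ∙-cong a′≈u′⁻¹ b′≈v′⁻¹ ⟩
      u′ ⁻¹ ∙ v′ ⁻¹  ≈⟨ ⁻¹-∙-comm u′ v′ ⟩
      (u′ ∙ v′) ⁻¹   ∎)
      where open ≈-Reasoning setoid

  ⊞-comm : ∀ X B {g} → T ((member X ⊞ B) g) → T ((member B ⊞ X) g)
  ⊞-comm X B {g} t = let b , b∈ , g-b∈X = ⋃⁻ (member X ⊕_) B t in
    ⊞⁺ (member-cong B) (member⁺ b∈) (member⁻ {X} g-b∈X) (sym (trans (comm b (g ∙ b ⁻¹)) (//-rightDividesˡ b g)))

module Generated {c ℓ} (G : FiniteAbelianGroup c ℓ) (S : List (FiniteAbelianGroup.Carrier G)) where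
  open FiniteAbelianGroup G
  open GroupSubsets G
  open import Data.List.Membership.Setoid.Properties using (∈-map⁺; ∈-map⁻; ∈-filter⁺; ∈-filter⁻)
  import Data.List.Relation.Unary.Unique.Setoid.Properties as Unique
  open import Algebra.Properties.AbelianGroup abGroup using (⁻¹-∙-comm)
  open import Algebra.Properties.Group group using (⁻¹-involutive; ε⁻¹≈ε; //-rightDividesˡ)

  Gen-ind : ∀ {q} (Q : Carrier → Set q) → (∀ {x y} → x ≈ y → Q x → Q y) → Q ε →
            (∀ {x s} → s ∈ S → Q x → Q (x ∙ s) × Q (x ∙ s ⁻¹)) → ∀ {g} → Gen G S g → Q g
  Gen-ind Q resp Qε step {g} g∈ = resp (identityˡ g) (proj₁ (translates g∈ Qε))
    where
    translates : ∀ {g} → Gen G S g → ∀ {x} → Q x → Q (x ∙ g) × Q (x ∙ g ⁻¹)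
    translates (gen s∈) Qx = step s∈ Qx
    translates gen0 {x} Qx =
      resp (sym (identityʳ x)) Qx , resp (trans (sym (identityʳ x)) (∙-congˡ (sym ε⁻¹≈ε))) Qx
    translates (gen+ {a} {b} a∈ b∈) {x} Qx =
      resp (assoc x a b) (proj₁ (translates b∈ (proj₁ (translates a∈ Qx)))) ,
      resp (trans (assoc x (a ⁻¹) (b ⁻¹)) (∙-congˡ (⁻¹-∙-comm a b)))
           (proj₂ (translates b∈ (proj₂ (translates a∈ Qx))))
    translates (gen- {a} a∈) Qx =
      proj₂ (translates a∈ Qx) , resp (∙-congˡ (sym (⁻¹-involutive a))) (proj₁ (translates a∈ Qx))
    translates (gen≈ a≈b a∈) Qx =
      resp (∙-congˡ a≈b) (proj₁ (translates a∈ Qx)) , resp (∙-congˡ (⁻¹-cong a≈b)) (proj₂ (translates a∈ Qx))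

  S⁻¹ : List Carrier
  S⁻¹ = map _⁻¹ S

  neighbours : Subset → Subset
  neighbours p = p ⊞ S ∪ p ⊞ S⁻¹

  step : Subset → Subset
  step p = p ∪ neighbours p

  Sound : Subset → Set (c ⊔ ℓ)
  Sound p = Congruent≈ p × (∀ {g} → T (p g) → Gen G S g)

  ⊞-sound : ∀ {p} → Sound p → ∀ {B} → (∀ {b} → b ∈ B → Gen G S b) → ∀ {g} → T ((p ⊞ B) g) → Gen G S g
  ⊞-sound {p} (_ , p⇒Gen) {B} B⇒Gen {g} t =
    let b , b∈ , p[g-b] = ⋃⁻ (p ⊕_) B t in gen≈ (//-rightDividesˡ b g) (gen+ (p⇒Gen p[g-b]) (B⇒Gen b∈))

  step-sound : ∀ {p} → Sound p → Sound (step p)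
  step-sound {p} sound@(p-cong , p⇒Gen) =
    ∪-cong p-cong (∪-cong (⊞-cong p-cong S) (⊞-cong p-cong S⁻¹)) , step⇒Gen
    where
    S⁻¹⇒Gen : ∀ {b} → b ∈ S⁻¹ → Gen G S b
    S⁻¹⇒Gen b∈ = let s , s∈ , b≈s⁻¹ = ∈-map⁻ setoid setoid b∈ in gen≈ (sym b≈s⁻¹) (gen- (gen s∈))
    step⇒Gen : ∀ {g} → T (step p g) → Gen G S g
    step⇒Gen t with ∪⁻ p (neighbours p) t
    ... | inj₁ pg = p⇒Gen pg
    ... | inj₂ t′ with ∪⁻ (p ⊞ S) (p ⊞ S⁻¹) t′
    ...   | inj₁ +S = ⊞-sound sound gen +S
    ...   | inj₂ -S = ⊞-sound sound S⁻¹⇒Gen -S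

  open Saturation elems elems-complete Sound proj₁ step step-sound (λ p → ∪⁺ˡ p (neighbours p))

  ｛ε｝-sound : Sound ｛ ε ｝
  ｛ε｝-sound = ｛｝-cong ε , λ g≈ε → gen≈ (sym (｛｝⁻ g≈ε)) gen0

  generated : Subset
  generated = saturate (length elems) ｛ ε ｝

  generated-sound : Sound generated
  generated-sound = saturate-inv (length elems) ｛ε｝-sound

  generated-cong : Congruent≈ generated
  generated-cong = proj₁ generated-sound

  neighbours-generated : ∀ {x} → T (neighbours generated x) → T (generated x)
  neighbours-generated = saturate-closed (length elems) ｛ε｝-sound (m≤m+n (length elems) _)
                       ∘ ∪⁺ʳ generated (neighbours generated)

  generated-complete : ∀ {g} → Gen G S g → T (generated g)
  generated-complete = Gen-ind (T ∘ generated) (T-resp generated-cong)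
    (saturate-inflationary (length elems) ｛ ε ｝ (｛｝⁺ refl)) closed
    where
    closed : ∀ {x s} → s ∈ S → T (generated x) → T (generated (x ∙ s)) × T (generated (x ∙ s ⁻¹))
    closed s∈ gx =
      neighbours-generated (∪⁺ˡ (generated ⊞ S) (generated ⊞ S⁻¹) (⊞⁺ generated-cong gx s∈ refl)) ,
      neighbours-generated (∪⁺ʳ (generated ⊞ S) (generated ⊞ S⁻¹)
                             (⊞⁺ generated-cong gx (∈-map⁺ setoid setoid ⁻¹-cong s∈) refl))

  elements : List Carrier
  elements = filterᵇ generated elems

  elements-unique : Unique elements
  elements-unique = Unique.filter⁺ setoid (T? ∘ generated) elems-unique

  ∈-elements⇒Gen : ∀ {g} → g ∈ elements → Gen G S g
  ∈-elements⇒Gen g∈ =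
    proj₂ generated-sound (proj₂ (∈-filter⁻ setoid (T? ∘ generated) (T-resp generated-cong) {xs = elems} g∈))

  Gen⇒∈-elements : ∀ {g} → Gen G S g → g ∈ elements
  Gen⇒∈-elements {g} g∈ =
    ∈-filter⁺ setoid (T? ∘ generated) (T-resp generated-cong) (elems-complete g) (generated-complete g∈)

module Isoperimetry {c ℓ} (G : FiniteAbelianGroup c ℓ) where
  open FiniteAbelianGroup G
  open GroupSubsets G
  open import Data.List.Membership.Setoid.Properties using (∈-resp-≈; ∈-map⁺; ∈-map⁻; ∈-filter⁺; ∈-filter⁻)
  open import Data.List.Properties using (length-map)
  import Data.List.Relation.Unary.All as All
  import Data.List.Relation.Unary.Unique.Setoid.Properties as Unique
  open import Algebra.Properties.Group group
    using ( //-rightDividesˡ; //-rightDividesʳ; \\-leftDividesˡ; ∙-cancelˡ; ∙-cancelʳ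
          ; ⁻¹-injective; ⁻¹-involutive; ε⁻¹≈ε; x∙y⁻¹≈ε⇒x≈y)
  open import Algebra.Properties.AbelianGroup abGroup using (⁻¹-∙-comm)
  open import Algebra.Properties.CommutativeSemigroup commutativeSemigroup using (xy∙z≈xz∙y)
  open import Data.List.Membership.Setoid setoid using (find)
  open import Data.List.Relation.Unary.All.Properties using (¬All⇒Any¬)
  import Relation.Binary.Reasoning.Setoid as ≈-Reasoning
  open import Algebra.Properties.CommutativeSemigroup +-commutativeSemigroup
    using (xy∙z≈zy∙x) renaming (interchange to +-interchange)
  open import Data.Nat.Induction using (<-wellFounded)
  open import Data.Product.Relation.Binary.Lex.Strict using (×-Lex; ×-wellFounded)
  open import Induction.WellFounded as WF using (WfRec)
  open import Data.Nat.Tactic.RingSolver using (solve-∀)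
  open Arithmetic

  record IsSubgroup (H : List Carrier) : Set (c ⊔ ℓ) where
    field
      H-unique  : Unique H
      ε∈H       : ε ∈ H
      ∙-closed  : ∀ {x y} → x ∈ H → y ∈ H → x ∙ y ∈ H
      ⁻¹-closed : ∀ {x} → x ∈ H → x ⁻¹ ∈ H

  module InSubgroup {H} (subgroup : IsSubgroup H) (j : ℕ) where
    open IsSubgroup subgroup

    k K n : ℕ
    k = 3 + j
    K = 3 + j + j
    n = length H

    -- Values of a subset outside H are irrelevant: only elements of H are counted.
    ∣_∣ : Subset → ℕ
    ∣ A ∣ = count A H

    record SidonBasis (B : List Carrier) : Set (c ⊔ ℓ) where
      field
        unique    : Unique B
        ε∈        : ε ∈ B
        sidon     : Sidon G B
        ⊆H        : ∀ {b} → b ∈ B → b ∈ H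
        size      : length B ≡ k
        -- B generates H, in the form of an induction principle.
        generates : ∀ Q → Congruent≈ Q → T (Q ε) →
                    (∀ {x b} → x ∈ H → b ∈ B → T (Q x) → T (Q (x ∙ b)) × T (Q (x ∙ b ⁻¹))) →
                    ∀ {h} → h ∈ H → T (Q h)

    record Separating (B : List Carrier) (A : Subset) : Set (c ⊔ ℓ) where
      field
        congruent  : Congruent≈ A
        nontrivial : 2 ≤ ∣ A ∣
        proper     : ∣ A ⊞ B ∣ + 2 ≤ n

    ∣A∣≤∣A⊞B∣ : ∀ {B} → ε ∈ B → ∀ {A} → Congruent≈ A → ∣ A ∣ ≤ ∣ A ⊞ B ∣
    ∣A∣≤∣A⊞B∣ ε∈B A-cong = count-mono H (λ _ → ⊆⊞ ε∈B A-cong)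

    ⊞-mono : ∀ {B} → (∀ {b} → b ∈ B → b ∈ H) → ∀ {A A′} → Congruent≈ A′ →
             A ⊆[ H ] A′ → A ⊞ B ⊆[ H ] A′ ⊞ B
    ⊞-mono {B} B⊆H {A} {A′} A′-cong A⊆A′ g∈ t =
      let b , b∈ , A[g-b] = ⋃⁻ (A ⊕_) B t in
      ⋃⁺ (A′ ⊕_) (⊕-resp A′-cong) b∈ (A⊆A′ (∙-closed g∈ (⁻¹-closed (B⊆H b∈))) A[g-b])

    count-⊕ : ∀ {A} → Congruent≈ A → ∀ {d} → d ∈ H → ∣ A ⊕ d ∣ ≡ ∣ A ∣
    count-⊕ {A} A-cong {d} d∈H = begin
      ∣ A ⊕ d ∣           ≡⟨ count-≐ H (λ g∈ → member⁺ ∘ ⊕⊆M g∈) (λ _ → M⊆⊕ ∘ member⁻) ⟩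
      count (member M) H ≡⟨ ≡.sym (count-member H-unique M-unique M⊆H) ⟩
      length M           ≡⟨ length-map (_∙ d) (filterᵇ A H) ⟩
      ∣ A ∣               ∎
      where
      open ≡.≡-Reasoning
      M : List Carrier
      M = map (_∙ d) (filterᵇ A H)
      A-filter⁻ : ∀ {a} → a ∈ filterᵇ A H → a ∈ H × T (A a)
      A-filter⁻ = ∈-filter⁻ setoid (T? ∘ A) (T-resp A-cong)
      M-unique : Unique M
      M-unique = Unique.map⁺ setoid setoid (∙-cancelʳ d _ _) (Unique.filter⁺ setoid (T? ∘ A) H-unique)
      M⊆H : ∀ {g} → g ∈ M → g ∈ H
      M⊆H g∈M = let a , a∈ , g≈ad = ∈-map⁻ setoid setoid g∈M in
        ∈-resp-≈ setoid (sym g≈ad) (∙-closed (proj₁ (A-filter⁻ a∈)) d∈H)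
      ⊕⊆M : ∀ {g} → g ∈ H → T ((A ⊕ d) g) → g ∈ M
      ⊕⊆M {g} g∈H A[g-d] = ∈-resp-≈ setoid (//-rightDividesˡ d g)
        (∈-map⁺ setoid setoid ∙-congʳ
          (∈-filter⁺ setoid (T? ∘ A) (T-resp A-cong) (∙-closed g∈H (⁻¹-closed d∈H)) A[g-d]))
      M⊆⊕ : ∀ {g} → g ∈ M → T ((A ⊕ d) g)
      M⊆⊕ g∈M = let a , a∈ , g≈ad = ∈-map⁻ setoid setoid g∈M in ⊕⁺ A-cong (proj₂ (A-filter⁻ a∈)) g≈ad

    count-⊕-⊞ : ∀ {A} → Congruent≈ A → ∀ {d} → d ∈ H → ∀ B → ∣ A ⊕ d ⊞ B ∣ ≡ ∣ A ⊞ B ∣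
    count-⊕-⊞ A-cong {d} d∈H B =
      ≡.trans (count-≐ H (λ _ → ⊕⊞⊆⊞⊕ A-cong d B) (λ _ → ⊞⊕⊆⊕⊞ A-cong d B)) (count-⊕ (⊞-cong A-cong B) d∈H)

    ⊞-submodular : ∀ {A A′} → Congruent≈ A → Congruent≈ A′ → ∀ B →
                   ∣ (A ∩ A′) ⊞ B ∣ + ∣ (A ∪ A′) ⊞ B ∣ ≤ ∣ A ⊞ B ∣ + ∣ A′ ⊞ B ∣
    ⊞-submodular {A} {A′} A-cong A′-cong B = begin
      ∣ (A ∩ A′) ⊞ B ∣ + ∣ (A ∪ A′) ⊞ B ∣   ≤⟨ +-mono-≤ (count-mono H (λ _ → ∩⊞⊆ A-cong A′-cong B))
                                                        (count-mono H (λ _ → ∪⊞⊆ A-cong A′-cong B)) ⟩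
      ∣ A ⊞ B ∩ A′ ⊞ B ∣ + ∣ A ⊞ B ∪ A′ ⊞ B ∣ ≡⟨ count-∩-∪ (A ⊞ B) (A′ ⊞ B) H ⟨
      ∣ A ⊞ B ∣ + ∣ A′ ⊞ B ∣                 ∎
      where open ≤-Reasoning

    SidonBasis-⁻¹ : ∀ {B} → SidonBasis B → SidonBasis (map _⁻¹ B)
    SidonBasis-⁻¹ {B} basis = record
      { unique    = Unique.map⁺ setoid setoid ⁻¹-injective unique
      ; ε∈        = ∈-resp-≈ setoid ε⁻¹≈ε (∈-map⁺ setoid setoid ⁻¹-cong ε∈)
      ; sidon     = sidon-⁻¹ sidon
      ; ⊆H        = λ b′∈ → let b , b∈ , b′≈b⁻¹ = ∈-map⁻ setoid setoid b′∈ in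
                      ∈-resp-≈ setoid (sym b′≈b⁻¹) (⁻¹-closed (⊆H b∈))
      ; size      = ≡.trans (length-map _⁻¹ B) size
      ; generates = λ Q Q-cong Qε step → generates Q Q-cong Qε λ {x} {b} x∈ b∈ Qx →
          let Q[x-b] , Q[x+b] = step x∈ (∈-map⁺ setoid setoid ⁻¹-cong b∈) Qx in
          T-resp Q-cong (∙-congˡ (⁻¹-involutive b)) Q[x+b] , Q[x-b]
      }
      where open SidonBasis basis

    ⊆⊕⇒closed : ∀ {A} → Congruent≈ A → ∀ {d} → d ∈ H → A ⊆[ H ] A ⊕ d →
                ∀ {x} → x ∈ H → T (A x) → T (A (x ∙ d))
    ⊆⊕⇒closed A-cong {d} d∈H A⊆A⊕d {x} x∈H Ax =
      ⊆∧count≥⇒⊇ H A-cong (⊕-cong A-cong d) A⊆A⊕d (≤-reflexive (count-⊕ A-cong d∈H))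
        (∙-closed x∈H d∈H) (T-resp A-cong (sym (//-rightDividesʳ d x)) Ax)

    translation-invariant⇒full : ∀ {B} → SidonBasis B → ∀ {A} → Congruent≈ A → 1 ≤ ∣ A ∣ →
                                 (∀ {b} → b ∈ B → A ⊆[ H ] A ⊕ b) → ∣ A ∣ ≡ n
    translation-invariant⇒full {B} basis {A} A-cong 1≤∣A∣ invariant with count-pos⇒∃ H 1≤∣A∣
    ... | a , a∈H , Aa = count-all H full
      where
      open SidonBasis basis using (⊆H; generates)
      Q : Subset
      Q x = A (a ∙ x)
      step : ∀ {x b} → x ∈ H → b ∈ B → T (Q x) → T (Q (x ∙ b)) × T (Q (x ∙ b ⁻¹))
      step {x} {b} x∈ b∈ Qx =
        T-resp A-cong (assoc a x b) (⊆⊕⇒closed A-cong (⊆H b∈) (invariant b∈) (∙-closed a∈H x∈) Qx) ,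
        T-resp A-cong (assoc a x (b ⁻¹)) (invariant b∈ (∙-closed a∈H x∈) Qx)
      full : ∀ {h} → h ∈ H → T (A h)
      full {h} h∈ = T-resp A-cong (\\-leftDividesˡ a h)
        (generates Q (A-cong ∘ ∙-congˡ) (T-resp A-cong (sym (identityʳ a)) Aa) step (∙-closed (⁻¹-closed a∈H) h∈))

    module Counterexample {B A} (basis : SidonBasis B) (separating : Separating B A)
      (excess : ∣ A ⊞ B ∣ < ∣ A ∣ + K)
      (minimal-excess : ∀ {B′ Y} → SidonBasis B′ → Separating B′ Y → ∣ A ⊞ B ∣ + ∣ Y ∣ ≤ ∣ Y ⊞ B′ ∣ + ∣ A ∣)
      (minimal-size : ∀ {B′ Y} → SidonBasis B′ → Separating B′ Y →
                      ∣ Y ⊞ B′ ∣ + ∣ A ∣ ≤ ∣ A ⊞ B ∣ + ∣ Y ∣ → ∣ A ∣ ≤ ∣ Y ∣)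
      where
      open SidonBasis basis
      open Separating separating renaming (congruent to A-cong)

      α σ : ℕ
      α = ∣ A ∣
      σ = ∣ A ⊞ B ∣

      α≤σ : α ≤ σ
      α≤σ = ∣A∣≤∣A⊞B∣ ε∈ A-cong

      σ+α≤n : σ + α ≤ n
      σ+α≤n = begin
        σ + α     ≤⟨ +-monoʳ-≤ σ α≤∣C∣ ⟩
        σ + ∣ C ∣ ≡⟨ count-∁ (A ⊞ B) H ⟩
        n         ∎
        where
        open ≤-Reasoning
        C : Subset
        C = ∁ (A ⊞ B)
        ∣C⊞B⁻¹∣+α≤n : ∣ C ⊞ map _⁻¹ B ∣ + α ≤ n
        ∣C⊞B⁻¹∣+α≤n = begin
          ∣ C ⊞ map _⁻¹ B ∣ + α ≤⟨ +-monoˡ-≤ α (count-mono H (λ _ → ∁⊞⊆∁ A-cong B)) ⟩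
          ∣ ∁ A ∣ + α            ≡⟨ +-comm ∣ ∁ A ∣ α ⟩
          α + ∣ ∁ A ∣            ≡⟨ count-∁ A H ⟩
          n                     ∎
        C-separating : Separating (map _⁻¹ B) C
        C-separating = record
          { congruent  = ∁-cong (⊞-cong A-cong B)
          ; nontrivial = +-cancelˡ-≤ σ 2 ∣ C ∣ (≤-trans proper (≤-reflexive (≡.sym (count-∁ (A ⊞ B) H))))
          ; proper     = ≤-trans (+-monoʳ-≤ _ nontrivial) ∣C⊞B⁻¹∣+α≤n
          }
        α≤∣C∣ : α ≤ ∣ C ∣
        α≤∣C∣ = minimal-size (SidonBasis-⁻¹ basis) C-separating
                  (≤-trans ∣C⊞B⁻¹∣+α≤n (≤-reflexive (≡.sym (count-∁ (A ⊞ B) H))))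

      module _ {d} (d∈H : d ∈ H) where
        private
          I U : Subset
          I = A ∩ A ⊕ d
          U = A ∪ A ⊕ d
          I-cong : Congruent≈ I
          I-cong = ∩-cong A-cong (⊕-cong A-cong d)
          U-cong : Congruent≈ U
          U-cong = ∪-cong A-cong (⊕-cong A-cong d)

          ∣I∣+∣U∣≡α+α : ∣ I ∣ + ∣ U ∣ ≡ α + α
          ∣I∣+∣U∣≡α+α = ≡.trans (≡.sym (count-∩-∪ A (A ⊕ d) H)) (cong (α +_) (count-⊕ A-cong d∈H))

          ∣I⊞B∣+∣U⊞B∣≤σ+σ : ∣ I ⊞ B ∣ + ∣ U ⊞ B ∣ ≤ σ + σ
          ∣I⊞B∣+∣U⊞B∣≤σ+σ = ≤-trans (⊞-submodular A-cong (⊕-cong A-cong d) B)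
                                    (≤-reflexive (cong (σ +_) (count-⊕-⊞ A-cong d∈H B)))

          I⊆A : I ⊆[ H ] A
          I⊆A _ = proj₁ ∘ ∩⁻ A (A ⊕ d)

          ∣I⊞B∣≤σ : ∣ I ⊞ B ∣ ≤ σ
          ∣I⊞B∣≤σ = count-mono H (⊞-mono ⊆H A-cong I⊆A)

          I-separating : 2 ≤ ∣ I ∣ → Separating B I
          I-separating 2≤∣I∣ = record
            { congruent = I-cong ; nontrivial = 2≤∣I∣ ; proper = ≤-trans (+-monoˡ-≤ 2 ∣I⊞B∣≤σ) proper }

          -- I strictly exceeds the minimal excess, yet I and U together have excess at most 2(σ - α).
          strict-excess-absurd : 2 ≤ ∣ I ∣ → σ + ∣ I ∣ < ∣ I ⊞ B ∣ + α → ⊥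
          strict-excess-absurd 2≤∣I∣ I-excess with ∣ U ⊞ B ∣ + 2 ≤? n
          ... | yes U-proper = <-irrefl ≡.refl $ begin-strict
            (σ + σ) + (∣ I ∣ + ∣ U ∣)         ≡⟨ +-interchange σ σ (∣ I ∣) (∣ U ∣) ⟩
            (σ + ∣ I ∣) + (σ + ∣ U ∣)         <⟨ +-mono-<-≤ I-excess (minimal-excess basis U-separating) ⟩
            (∣ I ⊞ B ∣ + α) + (∣ U ⊞ B ∣ + α) ≡⟨ +-interchange (∣ I ⊞ B ∣) α (∣ U ⊞ B ∣) α ⟩
            (∣ I ⊞ B ∣ + ∣ U ⊞ B ∣) + (α + α) ≤⟨ +-mono-≤ ∣I⊞B∣+∣U⊞B∣≤σ+σ (≤-reflexive (≡.sym ∣I∣+∣U∣≡α+α)) ⟩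
            (σ + σ) + (∣ I ∣ + ∣ U ∣)         ∎
            where
            open ≤-Reasoning
            U-separating : Separating B U
            U-separating = record
              { congruent = U-cong
              ; nontrivial = ≤-trans nontrivial (count-mono H (λ _ → ∪⁺ˡ A (A ⊕ d)))
              ; proper = U-proper }
          ... | no U-improper = refute 1 (totals σ α n (∣ I ∣) (∣ I ⊞ B ∣) (∣ U ⊞ B ∣)) $
              +-mono-≤ I-excess (+-mono-≤ ∣I⊞B∣+∣U⊞B∣≤σ+σ (+-mono-≤ σ+α≤n (+-mono-≤ (≰⇒> U-improper) 2≤∣I∣)))
            where
            totals : ∀ σ α n i iB uB →
              suc (σ + i) + ((iB + uB) + ((σ + α) + (suc n + 2)))
              ≡ (iB + α) + ((σ + σ) + (n + ((uB + 2) + i))) + suc 1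
            totals = solve-∀

        periodic : 2 ≤ ∣ A ∩ A ⊕ d ∣ → A ⊆[ H ] A ⊕ d
        periodic 2≤∣I∣ with ∣ I ⊞ B ∣ + α ≤? σ + ∣ I ∣
        ... | yes ≤ = λ g∈ Ag → proj₂ (∩⁻ A (A ⊕ d)
                        (⊆∧count≥⇒⊇ H I-cong A-cong I⊆A (minimal-size basis (I-separating 2≤∣I∣) ≤) g∈ Ag))
        ... | no  ≰ = ⊥-elim (strict-excess-absurd 2≤∣I∣ (≰⇒> ≰))

      K<α : K < α
      K<α = small-excess⇒K<α j nontrivial bound excess
        where
        open ≤-Reasoning
        elements-of-A : List Carrier
        elements-of-A = filterᵇ A H
        ∈-elements⁻ : ∀ {a} → a ∈ elements-of-A → a ∈ H × T (A a)
        ∈-elements⁻ = ∈-filter⁻ setoid (T? ∘ A) (T-resp A-cong)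
        sizes : All (λ a → k ≤ ∣ member B ⊕ a ∣) elements-of-A
        sizes = All.tabulateₛ setoid λ {a} a∈ → ≤-reflexive (begin-equality
          k                   ≡⟨ size ⟨
          length B            ≡⟨ count-member H-unique unique ⊆H ⟩
          ∣ member B ∣         ≡⟨ count-⊕ (member-cong B) (proj₁ (∈-elements⁻ a∈)) ⟨
          ∣ member B ⊕ a ∣     ∎)
        pairs : AllPairs (λ a a′ → ∣ member B ⊕ a ∩ member B ⊕ a′ ∣ ≤ 1) elements-of-A
        pairs = distinct-pairs (Unique.filter⁺ setoid (T? ∘ A) H-unique)
                               (λ _ _ a≉a′ → translates-meet-once sidon a≉a′ H H-unique)
        ⋃⊆A⊞B : ⋃ (member B ⊕_) elements-of-A ⊆[ H ] A ⊞ B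
        ⋃⊆A⊞B {g} _ t = let a , a∈ , g-a∈B = ⋃⁻ (member B ⊕_) elements-of-A t in
          ⊞⁺ A-cong (proj₂ (∈-elements⁻ a∈)) (member⁻ {B} g-a∈B)
             (sym (trans (comm a (g ∙ a ⁻¹)) (//-rightDividesˡ a g)))
        bound : α * k ≤ σ + C₂ α
        bound = begin
          α * k                                    ≤⟨ bonferroni (member B ⊕_) H k elements-of-A sizes pairs ⟩
          ∣ ⋃ (member B ⊕_) elements-of-A ∣ + C₂ α ≤⟨ +-monoˡ-≤ (C₂ α) (count-mono H ⋃⊆A⊞B) ⟩
          σ + C₂ α                                 ∎

      full-absurd : α ≡ n → ⊥
      full-absurd α≡n = m+1+n≰m σ (≤-trans proper (≤-trans (≤-reflexive (≡.sym α≡n)) α≤σ))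

      disjoint-absurd : ∀ {b} → b ∈ B → ∣ A ∩ A ⊕ b ∣ ≡ 0 → ⊥
      disjoint-absurd {b} b∈ disjoint = <-irrefl ≡.refl $ begin-strict
        α + α                           ≡⟨ cong (α +_) (count-⊕ A-cong (⊆H b∈)) ⟨
        α + ∣ A ⊕ b ∣                   ≡⟨ count-∩-∪ A (A ⊕ b) H ⟩
        ∣ A ∩ A ⊕ b ∣ + ∣ A ∪ A ⊕ b ∣   ≡⟨ cong (_+ ∣ A ∪ A ⊕ b ∣) disjoint ⟩
        ∣ A ∪ A ⊕ b ∣                   ≤⟨ count-mono H (λ _ → ∪⊆A⊞B) ⟩
        σ                               <⟨ excess ⟩
        α + K                           <⟨ +-monoʳ-< α K<α ⟩
        α + α                           ∎
        where
        open ≤-Reasoning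
        ∪⊆A⊞B : ∀ {g} → T ((A ∪ A ⊕ b) g) → T ((A ⊞ B) g)
        ∪⊆A⊞B t with ∪⁻ A (A ⊕ b) t
        ... | inj₁ Ag    = ⊆⊞ ε∈ A-cong Ag
        ... | inj₂ A[g-b] = ⋃⁺ (A ⊕_) (⊕-resp A-cong) b∈ A[g-b]

      no-period : ∀ {d} → d ∈ H → d ≉ ε → A ⊆[ H ] A ⊕ d → ⊥
      no-period {d} d∈H d≉ε A⊆A⊕d with All.all? (λ b → 2 ≤? ∣ A ∩ A ⊕ b ∣) B
      ... | yes overlapping = full-absurd $ translation-invariant⇒full basis A-cong (≤-trans (s≤s z≤n) nontrivial)
              λ b∈ → periodic (⊆H b∈) (All.lookupₛ setoid overlapping-resp overlapping b∈)
        where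
        overlapping-resp : ∀ {b b′} → b ≈ b′ → 2 ≤ ∣ A ∩ A ⊕ b ∣ → 2 ≤ ∣ A ∩ A ⊕ b′ ∣
        overlapping-resp {b} {b′} b≈b′ 2≤ = ≤-trans 2≤ (count-mono H λ _ t →
          let Ag , A[g-b] = ∩⁻ A (A ⊕ b) t in ∩⁺ A (A ⊕ b′) Ag (⊕-resp A-cong b≈b′ A[g-b]))
      ... | no ¬overlapping with find (¬All⇒Any¬ (λ b → 2 ≤? ∣ A ∩ A ⊕ b ∣) B ¬overlapping)
      ...   | b , b∈ , ¬2≤ = disjoint-absurd b∈ (count-none H (λ x∈ t → ¬2≤ (two-points x∈ t)))
        where
        closed : ∀ {x} → x ∈ H → T (A x) → T (A (x ∙ d))
        closed = ⊆⊕⇒closed A-cong d∈H A⊆A⊕d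
        two-points : ∀ {x} → x ∈ H → T ((A ∩ A ⊕ b) x) → 2 ≤ ∣ A ∩ A ⊕ b ∣
        two-points {x} x∈ t = ∈₂⇒count≥2 H H-unique (∩-cong A-cong (⊕-cong A-cong b)) x∈ (∙-closed x∈ d∈H)
          (λ x≈x+d → d≉ε (∙-cancelˡ x d ε (trans (sym x≈x+d) (sym (identityʳ x))))) t
          (∩⁺ A (A ⊕ b) (closed x∈ Ax)
            (T-resp A-cong (xy∙z≈xz∙y x (b ⁻¹) d) (closed (∙-closed x∈ (⁻¹-closed (⊆H b∈))) A[x-b])))
          where
          Ax : T (A x)
          Ax = proj₁ (∩⁻ A (A ⊕ b) t)
          A[x-b] : T ((A ⊕ b) x)
          A[x-b] = proj₂ (∩⁻ A (A ⊕ b) t)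

      translates-of-A-meet-once : ∀ {b b′} → b ∈ B → b′ ∈ B → b ≉ b′ → ∣ A ⊕ b ∩ A ⊕ b′ ∣ ≤ 1
      translates-of-A-meet-once {b} {b′} b∈ b′∈ b≉b′ with ∣ A ⊕ b ∩ A ⊕ b′ ∣ ≤? 1
      ... | yes ≤1 = ≤1
      ... | no  ≰1 = ⊥-elim (no-period d∈H d≉ε (periodic d∈H (≤-trans (≰⇒> ≰1) (≤-reflexive overlap≡))))
        where
        d : Carrier
        d = b′ ∙ b ⁻¹
        d∈H : d ∈ H
        d∈H = ∙-closed (⊆H b′∈) (⁻¹-closed (⊆H b∈))
        d≉ε : d ≉ ε
        d≉ε d≈ε = b≉b′ (sym (x∙y⁻¹≈ε⇒x≈y b′ b d≈ε))
        shift : ∀ g → (g ∙ b ⁻¹) ∙ d ⁻¹ ≈ g ∙ b′ ⁻¹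
        shift g = begin
          (g ∙ b ⁻¹) ∙ (b′ ∙ b ⁻¹) ⁻¹      ≈⟨ ∙-congˡ (⁻¹-∙-comm b′ (b ⁻¹)) ⟨
          (g ∙ b ⁻¹) ∙ (b′ ⁻¹ ∙ b ⁻¹ ⁻¹)   ≈⟨ ∙-congˡ (comm (b′ ⁻¹) (b ⁻¹ ⁻¹)) ⟩
          (g ∙ b ⁻¹) ∙ (b ⁻¹ ⁻¹ ∙ b′ ⁻¹)   ≈⟨ assoc (g ∙ b ⁻¹) (b ⁻¹ ⁻¹) (b′ ⁻¹) ⟨
          ((g ∙ b ⁻¹) ∙ b ⁻¹ ⁻¹) ∙ b′ ⁻¹   ≈⟨ ∙-congʳ (//-rightDividesʳ (b ⁻¹) g) ⟩
          g ∙ b′ ⁻¹                         ∎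
          where open ≈-Reasoning setoid
        overlap≡ : ∣ A ⊕ b ∩ A ⊕ b′ ∣ ≡ ∣ A ∩ A ⊕ d ∣
        overlap≡ = ≡.trans (count-cong H (λ {g} _ → cong (A (g ∙ b ⁻¹) ∧_) (A-cong (sym (shift g)))))
                          (count-⊕ (∩-cong A-cong (⊕-cong A-cong d)) (⊆H b∈))

      absurd : ⊥
      absurd = small-excess-absurd j K<α bound excess
        where
        bound : k * α ≤ σ + C₂ k
        bound = subst (λ m → m * α ≤ σ + C₂ m) size $
          bonferroni (A ⊕_) H α B (All.tabulateₛ setoid λ b∈ → ≤-reflexive (≡.sym (count-⊕ A-cong (⊆H b∈))))
                                  (distinct-pairs unique translates-of-A-meet-once)

    _<ₗₑₓ_ : ℕ × ℕ → ℕ × ℕ → Set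
    _<ₗₑₓ_ = ×-Lex _≡_ _<_ _<_

    excess-of : ∀ {B A} → SidonBasis B → Separating B A → ∃ λ e → ∣ A ∣ + e ≡ ∣ A ⊞ B ∣
    excess-of basis separating = m≤n⇒∃[o]m+o≡n (∣A∣≤∣A⊞B∣ (SidonBasis.ε∈ basis) (Separating.congruent separating))

    module Minimality {B A e} (∣A∣+e≡σ : ∣ A ∣ + e ≡ ∣ A ⊞ B ∣) (e<K : e < K)
      (smaller-bound : ∀ {B′ Y e′} → SidonBasis B′ → Separating B′ Y → ∣ Y ∣ + e′ ≡ ∣ Y ⊞ B′ ∣ →
                       (e′ , ∣ Y ∣) <ₗₑₓ (e , ∣ A ∣) → K ≤ e′) where
      open ≤-Reasoning

      α σ : ℕ
      α = ∣ A ∣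
      σ = ∣ A ⊞ B ∣

      excess : σ < α + K
      excess = subst (_< α + K) ∣A∣+e≡σ (+-monoʳ-< α e<K)

      private
        not-smaller : ∀ {B′ Y} → SidonBasis B′ → Separating B′ Y → ∀ {e′} → ∣ Y ∣ + e′ ≡ ∣ Y ⊞ B′ ∣ →
                      (e′ , ∣ Y ∣) <ₗₑₓ (e , α) → ⊥
        not-smaller basis′ separating′ {e′} ∣Y∣+e′≡ lex =
          <⇒≱ e<K (≤-trans (smaller-bound basis′ separating′ ∣Y∣+e′≡ lex) e′≤e)
          where
          e′≤e : e′ ≤ e
          e′≤e = [ <⇒≤ , ≤-reflexive ∘ proj₁ ]′ lex

      minimal-excess : ∀ {B′ Y} → SidonBasis B′ → Separating B′ Y → σ + ∣ Y ∣ ≤ ∣ Y ⊞ B′ ∣ + α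
      minimal-excess {B′} {Y} basis′ separating′ with excess-of basis′ separating′
      ... | e′ , ∣Y∣+e′≡ with e ≤? e′
      ...   | no  e≰e′ = ⊥-elim (not-smaller basis′ separating′ ∣Y∣+e′≡ (inj₁ (≰⇒> e≰e′)))
      ...   | yes e≤e′ = begin
        σ + ∣ Y ∣         ≡⟨ cong (_+ ∣ Y ∣) ∣A∣+e≡σ ⟨
        α + e + ∣ Y ∣     ≡⟨ xy∙z≈zy∙x α e (∣ Y ∣) ⟩
        ∣ Y ∣ + e + α     ≤⟨ +-monoˡ-≤ α (+-monoʳ-≤ (∣ Y ∣) e≤e′) ⟩
        ∣ Y ∣ + e′ + α    ≡⟨ cong (_+ α) ∣Y∣+e′≡ ⟩
        ∣ Y ⊞ B′ ∣ + α    ∎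

      minimal-size : ∀ {B′ Y} → SidonBasis B′ → Separating B′ Y → ∣ Y ⊞ B′ ∣ + α ≤ σ + ∣ Y ∣ → α ≤ ∣ Y ∣
      minimal-size {B′} {Y} basis′ separating′ ≤σ+∣Y∣ with α ≤? ∣ Y ∣ | excess-of basis′ separating′
      ... | yes α≤∣Y∣ | _ = α≤∣Y∣
      ... | no  α≰∣Y∣ | e′ , ∣Y∣+e′≡ with m≤n⇒m<n∨m≡n e′≤e
        where
        e′≤e : e′ ≤ e
        e′≤e = +-cancelˡ-≤ (∣ Y ∣) e′ e $ +-cancelʳ-≤ α (∣ Y ∣ + e′) (∣ Y ∣ + e) $ begin
          ∣ Y ∣ + e′ + α  ≡⟨ cong (_+ α) ∣Y∣+e′≡ ⟩
          ∣ Y ⊞ B′ ∣ + α  ≤⟨ ≤σ+∣Y∣ ⟩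
          σ + ∣ Y ∣       ≡⟨ cong (_+ ∣ Y ∣) ∣A∣+e≡σ ⟨
          α + e + ∣ Y ∣   ≡⟨ xy∙z≈zy∙x α e (∣ Y ∣) ⟩
          ∣ Y ∣ + e + α   ∎
      ...   | inj₁ e′<e = ⊥-elim (not-smaller basis′ separating′ ∣Y∣+e′≡ (inj₁ e′<e))
      ...   | inj₂ e′≡e = ⊥-elim (not-smaller basis′ separating′ ∣Y∣+e′≡ (inj₂ (e′≡e , ≰⇒> α≰∣Y∣)))

    -- Induction on the excess |A ⊞ B| - |A| and then on |A|: a minimal counterexample is an atom.
    isoperimetric : ∀ {B A} → SidonBasis B → Separating B A → ∣ A ∣ + K ≤ ∣ A ⊞ B ∣
    isoperimetric {B} {A} basis separating with excess-of basis separating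
    ... | e , ∣A∣+e≡σ = ≤-trans (+-monoʳ-≤ ∣ A ∣ (bound (e , ∣ A ∣) basis separating ≡.refl ∣A∣+e≡σ))
                                (≤-reflexive ∣A∣+e≡σ)
      where
      Bound : ℕ × ℕ → Set (c ⊔ ℓ)
      Bound (e , a) = ∀ {B A} → SidonBasis B → Separating B A → ∣ A ∣ ≡ a → ∣ A ∣ + e ≡ ∣ A ⊞ B ∣ → K ≤ e

      step : ∀ m → WfRec _<ₗₑₓ_ Bound m → Bound m
      step (e , _) smaller {B} {A} basis separating ≡.refl ∣A∣+e≡σ with K ≤? e
      ... | yes K≤e = K≤e
      ... | no  K≰e = ⊥-elim (Counterexample.absurd basis separating excess minimal-excess minimal-size)
        where
        open Minimality {B} {A} ∣A∣+e≡σ (≰⇒> K≰e)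
               (λ basis′ separating′ eq lex → smaller lex basis′ separating′ ≡.refl eq)

      bound : ∀ m → Bound m
      bound = WF.All.wfRec (×-wellFounded <-wellFounded <-wellFounded) _ Bound step

module SidonSeparation {c ℓ} (G : FiniteAbelianGroup c ℓ) (S : List (FiniteAbelianGroup.Carrier G))
  (S-unique : FiniteAbelianGroup.Unique G S) (ε∈S : FiniteAbelianGroup._∈_ G (FiniteAbelianGroup.ε G) S)
  (sidon : Sidon G S) (j : ℕ) (∣S∣≡k : length S ≡ 3 + j) where
  open FiniteAbelianGroup G
  open GroupSubsets G
  open Generated G S
  open Isoperimetry G
  open import Data.List.Membership.Setoid.Properties using (∈-resp-≈; ∈-filter⁺; ∈-filter⁻)
  import Data.List.Relation.Unary.All as All
  import Data.List.Relation.Unary.Unique.Setoid.Properties as Unique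
  open import Algebra.Properties.Group group using (//-rightDividesˡ)
  open import Data.Nat.Tactic.RingSolver using (solve-∀)

  H : List Carrier
  H = elements

  subgroup : IsSubgroup H
  subgroup = record
    { H-unique  = elements-unique
    ; ε∈H       = Gen⇒∈-elements gen0
    ; ∙-closed  = λ x∈ y∈ → Gen⇒∈-elements (gen+ (∈-elements⇒Gen x∈) (∈-elements⇒Gen y∈))
    ; ⁻¹-closed = λ x∈ → Gen⇒∈-elements (gen- (∈-elements⇒Gen x∈))
    }

  open IsSubgroup subgroup
  open InSubgroup subgroup j

  basis : SidonBasis S
  basis = record
    { unique    = S-unique
    ; ε∈        = ε∈S
    ; sidon     = sidon
    ; ⊆H        = Gen⇒∈-elements ∘ gen
    ; size      = ∣S∣≡k
    ; generates = λ Q Q-cong Qε step {h} h∈ →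
        proj₂ (Gen-ind (λ x → x ∈ H × T (Q x))
                       (λ x≈y (x∈ , Qx) → ∈-resp-≈ setoid x≈y x∈ , T-resp Q-cong x≈y Qx)
                       (ε∈H , Qε)
                       (λ s∈ (x∈ , Qx) → let Q[x+s] , Q[x-s] = step x∈ s∈ Qx in
                          (∙-closed x∈ (Gen⇒∈-elements (gen s∈)) , Q[x+s]) ,
                          (∙-closed x∈ (⁻¹-closed (Gen⇒∈-elements (gen s∈))) , Q[x-s]))
                       (∈-elements⇒Gen h∈))
    }

  HasCard⇒≡count : ∀ {q} {P : Carrier → Set q} {m} (p : Subset) → (∀ {x y} → x ≈ y → P x → P y) →
                   (∀ {x} → P x → x ∈ H) → (∀ {x} → P x → T (p x)) → (∀ {x} → x ∈ H → T (p x) → P x) →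
                   HasCard G P m → m ≡ ∣ p ∣
  HasCard⇒≡count {m = m} p P-resp P⊆H P⊆p p⊆P (L , ∣L∣≡m , L-unique , all-P , complete) = begin
    m                  ≡⟨ ∣L∣≡m ⟨
    length L           ≡⟨ count-member H-unique L-unique (P⊆H ∘ All.lookupₛ setoid P-resp all-P) ⟩
    count (member L) H ≡⟨ count-≐ H (λ _ → P⊆p ∘ All.lookupₛ setoid P-resp all-P ∘ member⁻)
                                    (λ x∈ → member⁺ ∘ complete _ ∘ p⊆P x∈) ⟩
    ∣ p ∣               ∎
    where open ≡.≡-Reasoning

  ∣⟨S⟩∣≡n : ∀ {m} → HasCard G (Gen G S) m → m ≡ n
  ∣⟨S⟩∣≡n card =
    ≡.trans (HasCard⇒≡count (λ _ → true) gen≈ Gen⇒∈-elements (λ _ → tt) (λ x∈ _ → ∈-elements⇒Gen x∈) card)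
            (count-all H (λ _ → tt))

  open SidonBasis basis using (⊆H)

  ⊆⟨S⟩⇒⊆H : ∀ {X} → All (Gen G S) X → ∀ {x} → x ∈ X → x ∈ H
  ⊆⟨S⟩⇒⊆H X⊆⟨S⟩ = Gen⇒∈-elements ∘ All.lookupₛ setoid gen≈ X⊆⟨S⟩

  SumSet⇒⊞ : ∀ {X g} → SumSet G X S g → T ((member X ⊞ S) g)
  SumSet⇒⊞ {X} (a , s , a∈ , s∈ , g≈as) = ⊞⁺ (member-cong X) (member⁺ a∈) s∈ g≈as

  ⊞⇒SumSet : ∀ {X g} → T ((member X ⊞ S) g) → SumSet G X S g
  ⊞⇒SumSet {X} {g} t = let s , s∈ , g-s∈X = ⋃⁻ (member X ⊕_) S t in
    g ∙ s ⁻¹ , s , member⁻ {X} g-s∈X , s∈ , sym (//-rightDividesˡ s g)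

  SumSet⊆H : ∀ {X} → All (Gen G S) X → ∀ {g} → SumSet G X S g → g ∈ H
  SumSet⊆H X⊆⟨S⟩ (a , s , a∈ , s∈ , g≈as) = ∈-resp-≈ setoid (sym g≈as) (∙-closed (⊆⟨S⟩⇒⊆H X⊆⟨S⟩ a∈) (⊆H s∈))

  ∣sumset∣≡ : ∀ {X m} → All (Gen G S) X → HasCard G (SumSet G X S) m → m ≡ ∣ member X ⊞ S ∣
  ∣sumset∣≡ {X} X⊆⟨S⟩ = HasCard⇒≡count (member X ⊞ S)
    (λ x≈y (a , s , a∈ , s∈ , x≈as) → a , s , a∈ , s∈ , trans (sym x≈y) x≈as)
    (SumSet⊆H X⊆⟨S⟩) SumSet⇒⊞ (λ _ → ⊞⇒SumSet)

  admissible⇒separating : ∀ {X m} → Admissible G S X m → Separating S (member X)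
  admissible⇒separating {X} (X-unique , X⊆⟨S⟩ , 2≤∣X∣ , sumset-card , _ , ⟨S⟩-card , m+2≤M) = record
    { congruent  = member-cong X
    ; nontrivial = subst (2 ≤_) (count-member H-unique X-unique (⊆⟨S⟩⇒⊆H X⊆⟨S⟩)) 2≤∣X∣
    ; proper     = subst₂ (λ m′ n′ → m′ + 2 ≤ n′) (∣sumset∣≡ X⊆⟨S⟩ sumset-card) (∣⟨S⟩∣≡n ⟨S⟩-card) m+2≤M
    }

  admissible⇒bound : ∀ {X m} → Admissible G S X m → K + length X ≤ m
  admissible⇒bound {X} admissible@(X-unique , X⊆⟨S⟩ , _ , sumset-card , _) =
    subst₂ _≤_ (≡.trans (cong (_+ K) (≡.sym (count-member H-unique X-unique (⊆⟨S⟩⇒⊆H X⊆⟨S⟩)))) (+-comm (length X) K))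
                 (≡.sym (∣sumset∣≡ X⊆⟨S⟩ sumset-card))
                 (isoperimetric basis (admissible⇒separating admissible))

  sumset-card : ∀ {X} → All (Gen G S) X → HasCard G (SumSet G X S) ∣ member X ⊞ S ∣
  sumset-card {X} X⊆⟨S⟩ =
    filterᵇ (member X ⊞ S) H , ≡.refl , Unique.filter⁺ setoid (T? ∘ (member X ⊞ S)) H-unique ,
    All.tabulateₛ setoid (⊞⇒SumSet ∘ proj₂ ∘ ∈-filter⁻ setoid (T? ∘ (member X ⊞ S)) X⊞S-resp {xs = H}) ,
    λ g g∈ → ∈-filter⁺ setoid (T? ∘ (member X ⊞ S)) X⊞S-resp (SumSet⊆H X⊆⟨S⟩ g∈) (SumSet⇒⊞ g∈)
    where
    X⊞S-resp : ∀ {x y} → x ≈ y → T ((member X ⊞ S) x) → T ((member X ⊞ S) y)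
    X⊞S-resp = T-resp (⊞-cong (member-cong X) S)

  ⟨S⟩-card : HasCard G (Gen G S) n
  ⟨S⟩-card = H , ≡.refl , H-unique , All.tabulateₛ setoid ∈-elements⇒Gen , λ _ → Gen⇒∈-elements

  nonzero-element : ∃ λ s → s ∈ S × s ≉ ε
  nonzero-element = let s , s∈ , s∉｛ε｝ = count-pos⇒∃ S 1≤∣S∖ε∣ in s , s∈ , ∁⁻ ｛ ε ｝ s∉｛ε｝ ∘ ｛｝⁺
    where
    open ≤-Reasoning
    1≤∣S∖ε∣ : 1 ≤ count (∁ ｛ ε ｝) S
    1≤∣S∖ε∣ = +-cancelˡ-≤ 1 1 _ $ begin
      2                                       ≤⟨ s≤s (s≤s z≤n) ⟩
      3 + j                                   ≡⟨ ∣S∣≡k ⟨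
      length S                                ≡⟨ count-∁ ｛ ε ｝ S ⟨
      count ｛ ε ｝ S + count (∁ ｛ ε ｝) S      ≡⟨ cong (_+ count (∁ ｛ ε ｝) S) (count-｛｝ S S-unique ε∈S) ⟩
      1 + count (∁ ｛ ε ｝) S                   ∎

  module ExtremalPair {s} (s∈S : s ∈ S) (s≉ε : s ≉ ε) where
    open SidonBasis basis using (size; unique)

    X₀ : List Carrier
    X₀ = ε ∷ s ∷ []

    X₀⊆⟨S⟩ : All (Gen G S) X₀
    X₀⊆⟨S⟩ = gen0 ∷ gen s∈S ∷ []

    -- |{0, s} + S| ≤ |S| + |s + S| - |S ∩ (s + S)|, and s lies in S ∩ (s + S).
    ∣X₀⊞S∣≤ : ∣ member X₀ ⊞ S ∣ ≤ K + 2
    ∣X₀⊞S∣≤ = +-cancelˡ-≤ 1 _ _ $ begin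
      1 + ∣ member X₀ ⊞ S ∣              ≤⟨ +-mono-≤ s∈S∩[s+S] (count-mono H λ _ → X₀⊞S⊆) ⟩
      ∣ F ε ∩ F s ∣ + ∣ F ε ∪ F s ∣      ≡⟨ count-∩-∪ (F ε) (F s) H ⟨
      ∣ F ε ∣ + ∣ F s ∣                  ≡⟨ cong₂ _+_ (∣F∣≡k ε∈H) (∣F∣≡k (⊆H s∈S)) ⟩
      k + k                             ≡⟨ k+k≡ j ⟩
      1 + (K + 2)                       ∎
      where
      open ≤-Reasoning
      F : Carrier → Subset
      F = member S ⊕_
      ∣F∣≡k : ∀ {d} → d ∈ H → ∣ F d ∣ ≡ k
      ∣F∣≡k d∈H = ≡.trans (count-⊕ (member-cong S) d∈H) (≡.trans (≡.sym (count-member H-unique unique ⊆H)) size)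
      s∈S∩[s+S] : 1 ≤ ∣ F ε ∩ F s ∣
      s∈S∩[s+S] = ∈⇒count-pos H (∩-cong (⊕-cong (member-cong S) ε) (⊕-cong (member-cong S) s)) (⊆H s∈S)
        (∩⁺ (F ε) (F s) (⊕⁺ (member-cong S) (member⁺ s∈S) (sym (identityʳ s)))
                        (⊕⁺ (member-cong S) (member⁺ ε∈S) (sym (identityˡ s))))
      X₀⊞S⊆ : ∀ {g} → T ((member X₀ ⊞ S) g) → T ((F ε ∪ F s) g)
      X₀⊞S⊆ t with ∪⁻ (F ε) (⋃ F (s ∷ [])) (⊞-comm X₀ S t)
      ... | inj₁ Fε = ∪⁺ˡ (F ε) (F s) Fε
      ... | inj₂ Fs∪∅ with ∪⁻ (F s) (λ _ → false) Fs∪∅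
      ...   | inj₁ Fs = ∪⁺ʳ (F ε) (F s) Fs
      k+k≡ : ∀ j → (3 + j) + (3 + j) ≡ 1 + (3 + j + j + 2)
      k+k≡ = solve-∀

  K≡2∣S∣∸3 : K ≡ 2 * length S ∸ 3
  K≡2∣S∣∸3 = ≡.trans (K≡ j) (cong (λ m → 2 * m ∸ 3) (≡.sym ∣S∣≡k))
    where
    -- The right-hand side is what 2 * (3 + j) ∸ 3 computes to.
    K≡ : ∀ j → 3 + j + j ≡ j + ((3 + j) + 0)
    K≡ = solve-∀

  κ₂ : Kappa2 G S K
  κ₂ with nonzero-element | K + 2 + 2 ≤? n
  ... | s , s∈S , s≉ε | yes room =
    inj₁ ((X₀ , _ , X₀-admissible) , (X₀ , _ , X₀-admissible , X₀-extremal) , λ _ _ → admissible⇒bound)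
    where
    open ExtremalPair s∈S s≉ε
    X₀-admissible : Admissible G S X₀ ∣ member X₀ ⊞ S ∣
    X₀-admissible = ((λ ε≈s → s≉ε (sym ε≈s)) ∷ []) ∷ [] ∷ [] , X₀⊆⟨S⟩ , ≤-refl , sumset-card X₀⊆⟨S⟩ ,
                    n , ⟨S⟩-card , ≤-trans (+-monoˡ-≤ 2 ∣X₀⊞S∣≤) room
    X₀-extremal : K + length X₀ ≡ ∣ member X₀ ⊞ S ∣
    X₀-extremal = ≤-antisym (admissible⇒bound X₀-admissible) ∣X₀⊞S∣≤
  ... | _ | no no-room = inj₂ (inseparable , K≡2∣S∣∸3)
    where
    inseparable : ¬ TwoSeparable G S
    inseparable (X , m , admissible@(_ , _ , 2≤∣X∣ , _ , M , card , m+2≤M)) = no-room $ begin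
      K + 2 + 2          ≤⟨ +-monoˡ-≤ 2 (+-monoʳ-≤ K 2≤∣X∣) ⟩
      K + length X + 2   ≤⟨ +-monoˡ-≤ 2 (admissible⇒bound admissible) ⟩
      m + 2              ≤⟨ m+2≤M ⟩
      M                  ≡⟨ ∣⟨S⟩∣≡n card ⟩
      n                  ∎
      where open ≤-Reasoning

lemma2p8 : {c ℓ : Level} (G : FiniteAbelianGroup c ℓ) (S : List (FiniteAbelianGroup.Carrier G)) →
    FiniteAbelianGroup.Unique G S →
    FiniteAbelianGroup._∈_ G (FiniteAbelianGroup.ε G) S →
    3 ≤ length S →
    Sidon G S →
    Kappa2 G S (2 * length S ∸ 3)
lemma2p8 G S S-unique ε∈S 3≤∣S∣ sidon =
  let j , 3+j≡∣S∣ = m≤n⇒∃[o]m+o≡n 3≤∣S∣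
      open SidonSeparation G S S-unique ε∈S sidon j (≡.sym 3+j≡∣S∣)
  in subst (Kappa2 G S) K≡2∣S∣∸3 κ₂
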